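{- Let $s\ge 0$ be an integer and let $S$ be an orientation of the undirected star $K_{1,s}$, with center $v$ (a vertex of total degree $s$). Then: (1) $S$ has the tournament Sidorenko property if and only if $S$ has a homomorphism to a single directed edge (i.e. all edges at $v$ point into $v$, or all point out of $v$); (2) $S$ has the tournament anti-Sidorenko property if and only if the in-degree and the out-degree of $v$ in $S$ differ by at most one.
   Context: All digraphs are oriented graphs (no loops, no antiparallel edges). A tournament is an orientation of a complete graph without loops. A homomorphism $D\to T$ between digraphs is a map $\phi:V(D)\to V(T)$ with $(\phi(x),\phi(y))\in E(T)$ for all $(x,y)\in E(D)$; $h_D(T)$ counts them and $t_D(T)=h_D(T)/v(T)^{v(D)}$. $D$ has the tournament Sidorenko property if $t_D(T)\ge (1-o(1))2^{ -e(D)}$ for all tournaments $T$, where $o(1)\to0$ as the number of vertices of $T$ tends to infinity; $D$ has the tournament anti-Sidorenko property if $t_D(T)\le 2^{ -e(D)}$ for all tournaments $T$. -}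

module Defs where

open import Data.Nat using (ℕ; zero; suc; _+_; _*_; _^_; _≤_; _≥_)
open import Data.Bool using (Bool; true; false; not; _∧_; _∨_; if_then_else_)
open import Data.Fin using (Fin; zero; suc)
open import Data.Vec using (Vec; []; _∷_; lookup)
open import Data.List using (List; []; _∷_; map; concatMap; allFin; [_])
open import Data.Bool.ListAction using (and)
open import Data.Nat.ListAction using (sum)
open import Data.Product using (Σ; ∃; _×_; _,_)
open import Relation.Binary.PropositionalEquality using (_≡_; _≢_; refl)

record Digraph : Set where
  field
    size      : ℕ
    E         : Fin size → Fin size → Bool
    noLoop    : ∀ x → E x x ≡ false
    noAntipar : ∀ x y → E x y ∧ E y x ≡ false
open Digraph public

record Tournament (n : ℕ) : Set where
  field
    T        : Fin n → Fin n → Bool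
    irrefl   : ∀ x → T x x ≡ false
    complete : ∀ x y → x ≢ y → T x y ≡ not (T y x)
open Tournament public

allB : {A : Set} → (A → Bool) → List A → Bool
allB p xs = and (map p xs)

allVecs : (m n : ℕ) → List (Vec (Fin n) m)
allVecs zero    n = [ [] ]
allVecs (suc m) n = concatMap (λ i → map (i ∷_) (allVecs m n)) (allFin n)

pairs : (m : ℕ) → List (Fin m × Fin m)
pairs m = concatMap (λ x → map (λ y → (x , y)) (allFin m)) (allFin m)

isHomB : (D : Digraph) {n : ℕ} → Tournament n → Vec (Fin n) (size D) → Bool
isHomB D Tn φ =
  allB (λ { (x , y) → not (E D x y) ∨ T Tn (lookup φ x) (lookup φ y) }) (pairs (size D))

homCount : (D : Digraph) {n : ℕ} → Tournament n → ℕ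
homCount D Tn = sum (map (λ φ → if isHomB D Tn φ then 1 else 0) (allVecs (size D) _))

edgeCount : Digraph → ℕ
edgeCount D = sum (map (λ { (x , y) → if E D x y then 1 else 0 }) (pairs (size D)))

-- Tournament Sidorenko property: t_D(T) ≥ (1 - o(1)) 2^{-e(D)}, i.e.
-- for every k there is N such that for every tournament T on n ≥ N vertices,
--   h_D(T) / n^{v(D)} ≥ (1 - 1/(k+1)) · 2^{-e(D)},
-- written multiplied out in ℕ.
TournamentSidorenko : Digraph → Set
TournamentSidorenko D =
  ∀ (k : ℕ) → ∃ λ (N : ℕ) → ∀ (n : ℕ) → n ≥ N → (Tn : Tournament n) →
    k * n ^ size D ≤ (suc k) * (homCount D Tn * 2 ^ edgeCount D)

-- Tournament anti-Sidorenko property: t_D(T) ≤ 2^{-e(D)} for all tournaments T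
-- (n ≥ 1 so that t_D(T) is defined).
TournamentAntiSidorenko : Digraph → Set
TournamentAntiSidorenko D =
  ∀ (n : ℕ) → n ≥ 1 → (Tn : Tournament n) →
    homCount D Tn * 2 ^ edgeCount D ≤ n ^ size D

IsHom : (D H : Digraph) → (Fin (size D) → Fin (size H)) → Set
IsHom D H φ = ∀ x y → E D x y ≡ true → E H (φ x) (φ y) ≡ true

edgeE : Fin 2 → Fin 2 → Bool
edgeE zero (suc zero) = true
edgeE _    _          = false

SingleEdge : Digraph
SingleEdge = record { size = 2 ; E = edgeE ; noLoop = nl ; noAntipar = na }
  where
  nl : ∀ x → edgeE x x ≡ false
  nl zero = refl
  nl (suc zero) = refl
  na : ∀ x y → edgeE x y ∧ edgeE y x ≡ false
  na zero zero = refl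
  na zero (suc zero) = refl
  na (suc zero) zero = refl
  na (suc zero) (suc zero) = refl

-- An orientation of the star K_{1,s}: center zero, leaves suc i.
-- o i = true  : the edge at leaf i points into the center (suc i → zero);
-- o i = false : it points out of the center (zero → suc i).
starE : (s : ℕ) → (Fin s → Bool) → Fin (suc s) → Fin (suc s) → Bool
starE s o zero    (suc i) = not (o i)
starE s o (suc i) zero    = o i
starE s o _       _       = false

Star : (s : ℕ) → (Fin s → Bool) → Digraph
Star s o = record { size = suc s ; E = starE s o ; noLoop = nl ; noAntipar = na }
  where
  nl : ∀ x → starE s o x x ≡ false
  nl zero = refl
  nl (suc i) = refl
  na : ∀ x y → starE s o x y ∧ starE s o y x ≡ false
  na zero zero = refl
  na zero (suc i) with o i
  ... | true = refl
  ... | false = refl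
  na (suc i) zero with o i
  ... | true = refl
  ... | false = refl
  na (suc i) (suc j) = refl

count : {s : ℕ} → (Fin s → Bool) → ℕ
count {s} p = sum (map (λ i → if p i then 1 else 0) (allFin s))

centerIndeg : (s : ℕ) → (Fin s → Bool) → ℕ
centerIndeg s o = count o

centerOutdeg : (s : ℕ) → (Fin s → Bool) → ℕ
centerOutdeg s o = count (λ i → not (o i))

-- If the centre has a in-leaves and b out-leaves, a homomorphism into a tournament T is an image v
-- of the centre together with in-neighbours of v for the in-leaves and out-neighbours for the
-- out-leaves, so h_S(T) = Σ_v d⁻(v)^a d⁺(v)^b and e(S) = a + b. For b = 0 (or a = 0) the power-mean
-- inequality and Σ_v d⁻(v) = n(n − 1)/2 give the Sidorenko bound. For |a − b| ≤ 1, AM-GM gives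
-- 4 d⁻(v) d⁺(v) ≤ n², and the one unpaired degree sums to at most n²/2, which is the
-- anti-Sidorenko bound. The converses use a transitive tournament on p vertices beating a rotational
-- tournament on 2k + 1 vertices, whose vertices have in-degree p + k and out-degree k: a chain of
-- about 2^(−a−b−1) n vertices pushes t_S(T) below (1 − ε) 2^(−a−b) when a, b ≥ 1, and the ratio
-- p : k = 2 : (b + 2) pushes it above 2^(−a−b) when a ≥ b + 2; reversing T swaps a and b.

module Submission where

open import Defs
open import Data.Nat
open import Data.Nat.Properties
open import Data.Nat.Tactic.RingSolver using (solve-∀)
open import Data.Nat.ListAction using (sum; product)
open import Data.Nat.ListAction.Properties using (sum-++; product-++)
open import Data.Bool using (Bool; true; false; not; _∨_; if_then_else_)
open import Data.Bool.Properties using (not-involutive; ¬-not)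
open import Data.Bool.ListAction using (and)
open import Data.Fin using (Fin; zero; suc; punchIn; toℕ; fromℕ<)
open import Data.Fin.Properties using (punchInᵢ≢i; toℕ-injective; toℕ-fromℕ<)
open import Relation.Nullary using (¬_; yes; no; contradiction)
open import Data.Vec using (Vec; []; _∷_; lookup)
open import Data.List as List using (List; []; _∷_; map; concatMap; tabulate; allFin)
open import Data.List.Properties using (map-++; map-∘)
open import Data.Product using (∃; _×_; _,_; proj₁; proj₂)
open import Data.Sum as Sum using (_⊎_; inj₁; inj₂)
open import Function using (_∘_)
open import Function.Bundles using (_⇔_; mk⇔)
open import Function.Construct.Composition using (_⇔-∘_)
open import Function.Construct.Identity using (⇔-id)
open import Function.Construct.Symmetry using (⇔-sym)
open import Relation.Binary.PropositionalEquality
open import Relation.Binary.Definitions using (tri<; tri≈; tri>)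

open import Algebra.Properties.CommutativeSemigroup *-commutativeSemigroup using (x∙yz≈y∙xz)
open import Algebra.Properties.Semiring.Sum +-*-semiring
  using (sum-syntax; ∑-distrib-+; ∑-comm; *-distribˡ-sum; *-distribʳ-sum; sum-remove)
  renaming (sum to ∑; sum-cong-≗ to ∑-cong)
open import Algebra.Properties.CommutativeMonoid.Sum *-1-commutativeMonoid
  using ()
  renaming (sum to ∏; sum-cong-≗ to ∏-cong; ∑-distrib-+ to ∏-distrib-*; sum-replicate-zero to ∏-const-1)

⟦_⟧ : Bool → ℕ
⟦ b ⟧ = if b then 1 else 0

∑-const : ∀ n c → ∑[ i < n ] c ≡ n * c
∑-const zero    c = refl
∑-const (suc n) c = cong (c +_) (∑-const n c)

∑-mono-≤ : ∀ {n} {f g : Fin n → ℕ} → (∀ i → f i ≤ g i) → ∑ f ≤ ∑ g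
∑-mono-≤ {zero}  f≤g = z≤n
∑-mono-≤ {suc n} f≤g = +-mono-≤ (f≤g zero) (∑-mono-≤ (f≤g ∘ suc))

∑-⟦⟧≤ : ∀ {n} (p : Fin n → Bool) → ∑[ i < n ] ⟦ p i ⟧ ≤ n
∑-⟦⟧≤ {n} p = subst (∑[ i < n ] ⟦ p i ⟧ ≤_) (trans (∑-const n 1) (*-identityʳ n)) (∑-mono-≤ ⟦⟧≤1)
  where
  ⟦⟧≤1 : ∀ i → ⟦ p i ⟧ ≤ 1
  ⟦⟧≤1 i with p i
  ... | true  = ≤-refl
  ... | false = z≤n

⟦⟧+⟦not⟧ : ∀ b → ⟦ b ⟧ + ⟦ not b ⟧ ≡ 1
⟦⟧+⟦not⟧ true  = refl
⟦⟧+⟦not⟧ false = refl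

∑-⟦⟧+∑-⟦not⟧ : ∀ {n} (p : Fin n → Bool) → ∑[ i < n ] ⟦ p i ⟧ + ∑[ i < n ] ⟦ not (p i) ⟧ ≡ n
∑-⟦⟧+∑-⟦not⟧ {n} p = begin
  ∑[ i < n ] ⟦ p i ⟧ + ∑[ i < n ] ⟦ not (p i) ⟧ ≡⟨ ∑-distrib-+ (⟦_⟧ ∘ p) (⟦_⟧ ∘ not ∘ p) ⟨
  ∑[ i < n ] (⟦ p i ⟧ + ⟦ not (p i) ⟧)           ≡⟨ ∑-cong {n} (⟦⟧+⟦not⟧ ∘ p) ⟩
  ∑[ i < n ] 1                                    ≡⟨ trans (∑-const n 1) (*-identityʳ n) ⟩
  n                                               ∎
  where open ≡-Reasoning

∑-⟦⟧≡0 : ∀ {n} (p : Fin n → Bool) → ∑[ i < n ] ⟦ p i ⟧ ≡ 0 → ∀ i → p i ≡ false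
∑-⟦⟧≡0 {suc n} p sum≡0 zero    = ⟦⟧≡0 (p zero) (m+n≡0⇒m≡0 _ sum≡0)
  where
  ⟦⟧≡0 : ∀ b → ⟦ b ⟧ ≡ 0 → b ≡ false
  ⟦⟧≡0 false _ = refl
∑-⟦⟧≡0 {suc n} p sum≡0 (suc i) = ∑-⟦⟧≡0 (p ∘ suc) (m+n≡0⇒n≡0 ⟦ p zero ⟧ sum≡0) i

∑-⟦false⟧ : ∀ {n} (p : Fin n → Bool) → (∀ i → p i ≡ false) → ∑[ i < n ] ⟦ p i ⟧ ≡ 0
∑-⟦false⟧ {n} p p≡false = trans (∑-cong {n} (cong ⟦_⟧ ∘ p≡false)) (trans (∑-const n 0) (*-zeroʳ n))

∏-if : ∀ {s} (o : Fin s → Bool) x y →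
  ∏ (λ i → if o i then x else y) ≡ x ^ ∑[ i < s ] ⟦ o i ⟧ * y ^ ∑[ i < s ] ⟦ not (o i) ⟧
∏-if {zero}  o x y = refl
∏-if {suc s} o x y with o zero
... | true  = trans (cong (x *_) (∏-if (o ∘ suc) x y)) (sym (*-assoc x _ _))
... | false = trans (cong (y *_) (∏-if (o ∘ suc) x y)) (x∙yz≈y∙xz y (x ^ ∑[ i < s ] ⟦ o (suc i) ⟧) _)

sum-map-tabulate : ∀ {A : Set} n (g : Fin n → A) (f : A → ℕ) →
  sum (map f (tabulate g)) ≡ ∑[ i < n ] f (g i)
sum-map-tabulate zero    g f = refl
sum-map-tabulate (suc n) g f = cong (f (g zero) +_) (sum-map-tabulate n (g ∘ suc) f)

product-map-tabulate : ∀ {A : Set} n (g : Fin n → A) (f : A → ℕ) →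
  product (map f (tabulate g)) ≡ ∏ (λ i → f (g i))
product-map-tabulate zero    g f = refl
product-map-tabulate (suc n) g f = cong (f (g zero) *_) (product-map-tabulate n (g ∘ suc) f)

sum-map-concatMap : ∀ {A B : Set} (f : B → ℕ) (g : A → List B) xs →
  sum (map f (concatMap g xs)) ≡ sum (map (λ x → sum (map f (g x))) xs)
sum-map-concatMap f g []       = refl
sum-map-concatMap f g (x ∷ xs) = begin
  sum (map f (g x List.++ concatMap g xs))               ≡⟨ cong sum (map-++ f (g x) _) ⟩
  sum (map f (g x) List.++ map f (concatMap g xs))       ≡⟨ sum-++ (map f (g x)) _ ⟩
  sum (map f (g x)) + sum (map f (concatMap g xs))       ≡⟨ cong (sum (map f (g x)) +_) (sum-map-concatMap f g xs) ⟩
  sum (map f (g x)) + sum (map (λ y → sum (map f (g y))) xs) ∎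
  where open ≡-Reasoning

product-map-concatMap : ∀ {A B : Set} (f : B → ℕ) (g : A → List B) xs →
  product (map f (concatMap g xs)) ≡ product (map (λ x → product (map f (g x))) xs)
product-map-concatMap f g []       = refl
product-map-concatMap f g (x ∷ xs) = begin
  product (map f (g x List.++ concatMap g xs))                   ≡⟨ cong product (map-++ f (g x) _) ⟩
  product (map f (g x) List.++ map f (concatMap g xs))           ≡⟨ product-++ (map f (g x)) _ ⟩
  product (map f (g x)) * product (map f (concatMap g xs))       ≡⟨ cong (product (map f (g x)) *_) (product-map-concatMap f g xs) ⟩
  product (map f (g x)) * product (map (λ y → product (map f (g y))) xs) ∎
  where open ≡-Reasoning

sum-map-pairs : ∀ m (f : Fin m × Fin m → ℕ) →
  sum (map f (pairs m)) ≡ ∑[ x < m ] ∑[ y < m ] f (x , y)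
sum-map-pairs m f =
  trans (sum-map-concatMap f _ (allFin m))
    (trans (sum-map-tabulate m (λ x → x) _)
      (∑-cong {m} λ x → trans (cong sum (sym (map-∘ (allFin m)))) (sum-map-tabulate m (λ y → y) _)))

product-map-pairs : ∀ m (f : Fin m × Fin m → ℕ) →
  product (map f (pairs m)) ≡ ∏ (λ x → ∏ (λ y → f (x , y)))
product-map-pairs m f =
  trans (product-map-concatMap f _ (allFin m))
    (trans (product-map-tabulate m (λ x → x) _)
      (∏-cong {m} λ x → trans (cong product (sym (map-∘ (allFin m)))) (product-map-tabulate m (λ y → y) _)))

⟦and⟧ : ∀ {A : Set} (p : A → Bool) xs → ⟦ and (map p xs) ⟧ ≡ product (map (⟦_⟧ ∘ p) xs)
⟦and⟧ p []       = refl
⟦and⟧ p (x ∷ xs) with p x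
... | true  = trans (⟦and⟧ p xs) (sym (+-identityʳ _))
... | false = refl

∑ᵛ : ∀ s {n} → (Vec (Fin n) s → ℕ) → ℕ
∑ᵛ zero    f = f []
∑ᵛ (suc s) f = ∑ (λ c → ∑ᵛ s (λ ψ → f (c ∷ ψ)))

sum-map-allVecs : ∀ s n (f : Vec (Fin n) s → ℕ) → sum (map f (allVecs s n)) ≡ ∑ᵛ s f
sum-map-allVecs zero    n f = +-identityʳ (f [])
sum-map-allVecs (suc s) n f =
  trans (sum-map-concatMap f _ (allFin n))
    (trans (sum-map-tabulate n (λ c → c) _)
      (∑-cong {n} λ c → trans (cong sum (sym (map-∘ (allVecs s n)))) (sum-map-allVecs s n _)))

∑ᵛ-cong : ∀ s {n} {f g : Vec (Fin n) s → ℕ} → (∀ ψ → f ψ ≡ g ψ) → ∑ᵛ s f ≡ ∑ᵛ s g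
∑ᵛ-cong zero    f≗g = f≗g []
∑ᵛ-cong (suc s) {n} f≗g = ∑-cong {n} λ c → ∑ᵛ-cong s (λ ψ → f≗g (c ∷ ψ))

∑ᵛ-*ˡ : ∀ s {n} c (f : Vec (Fin n) s → ℕ) → ∑ᵛ s (λ ψ → c * f ψ) ≡ c * ∑ᵛ s f
∑ᵛ-*ˡ zero    c f = refl
∑ᵛ-*ˡ (suc s) {n} c f =
  trans (∑-cong {n} λ x → ∑ᵛ-*ˡ s c (λ ψ → f (x ∷ ψ)))
    (sym (*-distribˡ-sum c (λ x → ∑ᵛ s (λ ψ → f (x ∷ ψ)))))

∑ᵛ-∏ : ∀ s {n} (h : Fin s → Fin n → ℕ) →
  ∑ᵛ s (λ ψ → ∏ (λ i → h i (lookup ψ i))) ≡ ∏ (λ i → ∑ (h i))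
∑ᵛ-∏ zero    h = refl
∑ᵛ-∏ (suc s) {n} h = begin
  ∑[ c < n ] ∑ᵛ s (λ ψ → h zero c * ∏ (λ i → h (suc i) (lookup ψ i)))
    ≡⟨ ∑-cong {n} (λ c → trans (∑ᵛ-*ˡ s (h zero c) _) (cong (h zero c *_) (∑ᵛ-∏ s (h ∘ suc)))) ⟩
  ∑[ c < n ] (h zero c * ∏ (λ i → ∑ (h (suc i))))
    ≡⟨ *-distribʳ-sum (∏ (λ i → ∑ (h (suc i)))) (h zero) ⟨
  ∑ (h zero) * ∏ (λ i → ∑ (h (suc i))) ∎
  where open ≡-Reasoning

-- Homomorphisms from a star

indeg outdeg : ∀ {n} → Tournament n → Fin n → ℕ
indeg  {n} τ v = ∑[ u < n ] ⟦ T τ u v ⟧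
outdeg {n} τ v = ∑[ u < n ] ⟦ T τ v u ⟧

degreeMoment : ∀ {n} → Tournament n → ℕ → ℕ → ℕ
degreeMoment {n} τ a b = ∑[ v < n ] (indeg τ v ^ a * outdeg τ v ^ b)

edgeCount≡∑∑ : ∀ D → edgeCount D ≡ ∑[ x < size D ] ∑[ y < size D ] ⟦ E D x y ⟧
edgeCount≡∑∑ D = sum-map-pairs (size D) _

⟦isHomB⟧ : ∀ D {n} (τ : Tournament n) φ →
  ⟦ isHomB D τ φ ⟧ ≡ ∏ (λ x → ∏ (λ y → ⟦ not (E D x y) ∨ T τ (lookup φ x) (lookup φ y) ⟧))
⟦isHomB⟧ D τ φ = trans (⟦and⟧ _ (pairs (size D))) (product-map-pairs (size D) _)

leafWeight : ∀ {n s} → Tournament n → (Fin s → Bool) → Fin n → Fin s → Fin n → ℕ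
leafWeight τ o c i u = if o i then ⟦ T τ u c ⟧ else ⟦ T τ c u ⟧

⟦isHomB-Star⟧ : ∀ {n} s (o : Fin s → Bool) (τ : Tournament n) c (ψ : Vec (Fin n) s) →
  ⟦ isHomB (Star s o) τ (c ∷ ψ) ⟧ ≡ ∏ (λ i → leafWeight τ o c i (lookup ψ i))
⟦isHomB-Star⟧ s o τ c ψ = begin
  ⟦ isHomB (Star s o) τ (c ∷ ψ) ⟧
    ≡⟨ ⟦isHomB⟧ (Star s o) τ (c ∷ ψ) ⟩
  (1 * ∏ centerToLeaf) * ∏ (λ i → leafToCenter i * ∏ {s} (λ _ → 1))
    ≡⟨ cong₂ _*_ (*-identityˡ (∏ centerToLeaf)) (∏-cong {s} λ i → trans (cong (leafToCenter i *_) (∏-const-1 s))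
                                                               (*-identityʳ _)) ⟩
  ∏ centerToLeaf * ∏ leafToCenter
    ≡⟨ ∏-distrib-* centerToLeaf leafToCenter ⟨
  ∏ (λ i → centerToLeaf i * leafToCenter i)
    ≡⟨ ∏-cong {s} leaf ⟩
  ∏ (λ i → leafWeight τ o c i (lookup ψ i)) ∎
  where
  open ≡-Reasoning
  centerToLeaf leafToCenter : Fin s → ℕ
  centerToLeaf i = ⟦ not (not (o i)) ∨ T τ c (lookup ψ i) ⟧
  leafToCenter i = ⟦ not (o i) ∨ T τ (lookup ψ i) c ⟧
  leaf : ∀ i → centerToLeaf i * leafToCenter i ≡ leafWeight τ o c i (lookup ψ i)
  leaf i with o i
  ... | true  = +-identityʳ _
  ... | false = *-identityʳ _

∑-leafWeight : ∀ {n s} (τ : Tournament n) (o : Fin s → Bool) c i →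
  ∑ (leafWeight τ o c i) ≡ (if o i then indeg τ c else outdeg τ c)
∑-leafWeight τ o c i with o i
... | true  = refl
... | false = refl

homCount-Star : ∀ {n} s (o : Fin s → Bool) (τ : Tournament n) →
  homCount (Star s o) τ ≡ degreeMoment τ (∑[ i < s ] ⟦ o i ⟧) (∑[ i < s ] ⟦ not (o i) ⟧)
homCount-Star {n} s o τ = begin
  homCount (Star s o) τ
    ≡⟨ sum-map-allVecs (suc s) n _ ⟩
  ∑[ c < n ] ∑ᵛ s (λ ψ → ⟦ isHomB (Star s o) τ (c ∷ ψ) ⟧)
    ≡⟨ ∑-cong {n} (λ c → trans (∑ᵛ-cong s (⟦isHomB-Star⟧ s o τ c)) (∑ᵛ-∏ s (leafWeight τ o c))) ⟩
  ∑[ c < n ] ∏ (λ i → ∑ (leafWeight τ o c i))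
    ≡⟨ ∑-cong {n} (λ c → trans (∏-cong {s} (∑-leafWeight τ o c)) (∏-if o _ _)) ⟩
  degreeMoment τ (∑[ i < s ] ⟦ o i ⟧) (∑[ i < s ] ⟦ not (o i) ⟧) ∎
  where open ≡-Reasoning

edgeCount-Star : ∀ s (o : Fin s → Bool) → edgeCount (Star s o) ≡ ∑[ i < s ] ⟦ o i ⟧ + ∑[ i < s ] ⟦ not (o i) ⟧
edgeCount-Star s o = begin
  edgeCount (Star s o)
    ≡⟨ edgeCount≡∑∑ (Star s o) ⟩
  ∑[ j < s ] ⟦ not (o j) ⟧ + ∑[ i < s ] (⟦ o i ⟧ + ∑[ j < s ] 0)
    ≡⟨ cong (∑[ j < s ] ⟦ not (o j) ⟧ +_) (∑-cong {s} noEdgeBetweenLeaves) ⟩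
  ∑[ j < s ] ⟦ not (o j) ⟧ + ∑[ i < s ] ⟦ o i ⟧
    ≡⟨ +-comm (∑[ j < s ] ⟦ not (o j) ⟧) _ ⟩
  ∑[ i < s ] ⟦ o i ⟧ + ∑[ i < s ] ⟦ not (o i) ⟧ ∎
  where
  open ≡-Reasoning
  noEdgeBetweenLeaves : ∀ i → ⟦ o i ⟧ + ∑[ j < s ] 0 ≡ ⟦ o i ⟧
  noEdgeBetweenLeaves i = trans (cong (⟦ o i ⟧ +_) (trans (∑-const s 0) (*-zeroʳ s))) (+-identityʳ _)

⟦T⟧+⟦T⟧ : ∀ {n} (τ : Tournament n) u v → u ≢ v → ⟦ T τ u v ⟧ + ⟦ T τ v u ⟧ ≡ 1
⟦T⟧+⟦T⟧ τ u v u≢v rewrite complete τ u v u≢v = trans (+-comm ⟦ not (T τ v u) ⟧ _) (⟦⟧+⟦not⟧ (T τ v u))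

indeg+outdeg : ∀ {n} (τ : Tournament n) v → suc (indeg τ v + outdeg τ v) ≡ n
indeg+outdeg {suc m} τ v = cong suc (begin
  indeg τ v + outdeg τ v
    ≡⟨ ∑-distrib-+ (λ u → ⟦ T τ u v ⟧) (λ u → ⟦ T τ v u ⟧) ⟨
  ∑[ u < suc m ] deg u
    ≡⟨ sum-remove {i = v} deg ⟩
  deg v + ∑[ j < m ] deg (punchIn v j)
    ≡⟨ cong₂ _+_ loop (∑-cong {m} λ j → ⟦T⟧+⟦T⟧ τ _ v (punchInᵢ≢i v j)) ⟩
  ∑[ j < m ] 1
    ≡⟨ trans (∑-const m 1) (*-identityʳ m) ⟩
  m ∎)
  where
  open ≡-Reasoning
  deg : Fin (suc m) → ℕ
  deg u = ⟦ T τ u v ⟧ + ⟦ T τ v u ⟧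
  loop : deg v ≡ 0
  loop rewrite irrefl τ v = refl

indeg+outdeg≤ : ∀ {n} (τ : Tournament n) v → indeg τ v + outdeg τ v ≤ n
indeg+outdeg≤ τ v = subst (indeg τ v + outdeg τ v ≤_) (indeg+outdeg τ v) (n≤1+n _)

∑indeg≡∑outdeg : ∀ {n} (τ : Tournament n) → ∑[ v < n ] indeg τ v ≡ ∑[ v < n ] outdeg τ v
∑indeg≡∑outdeg τ = ∑-comm (λ v u → ⟦ T τ u v ⟧)

2∑indeg+n≡n² : ∀ {n} (τ : Tournament n) → 2 * ∑[ v < n ] indeg τ v + n ≡ n * n
2∑indeg+n≡n² {n} τ = begin
  2 * ∑[ v < n ] indeg τ v + n
    ≡⟨ cong (λ x → ∑[ v < n ] indeg τ v + x + n) (trans (+-identityʳ _) (∑indeg≡∑outdeg τ)) ⟩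
  ∑[ v < n ] indeg τ v + ∑[ v < n ] outdeg τ v + n
    ≡⟨ cong₂ _+_ (∑-distrib-+ (indeg τ) (outdeg τ)) (trans (∑-const n 1) (*-identityʳ n)) ⟨
  ∑[ v < n ] (indeg τ v + outdeg τ v) + ∑[ v < n ] 1
    ≡⟨ ∑-distrib-+ (λ v → indeg τ v + outdeg τ v) (λ _ → 1) ⟨
  ∑[ v < n ] (indeg τ v + outdeg τ v + 1)
    ≡⟨ ∑-cong {n} (λ v → trans (+-comm _ 1) (indeg+outdeg τ v)) ⟩
  ∑[ v < n ] n
    ≡⟨ ∑-const n n ⟩
  n * n ∎
  where open ≡-Reasoning

2∑outdeg+n≡n² : ∀ {n} (τ : Tournament n) → 2 * ∑[ v < n ] outdeg τ v + n ≡ n * n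
2∑outdeg+n≡n² {n} τ = trans (cong (λ x → 2 * x + n) (sym (∑indeg≡∑outdeg τ))) (2∑indeg+n≡n² τ)

^-distribʳ-* : ∀ m n k → (m * n) ^ k ≡ m ^ k * n ^ k
^-distribʳ-* m n zero    = refl
^-distribʳ-* m n (suc k) = trans (cong (m * n *_) (^-distribʳ-* m n k)) ([m*n]*[o*p]≡[m*o]*[n*p] m n (m ^ k) (n ^ k))

4mn≤[m+n]² : ∀ m n → 4 * (m * n) ≤ (m + n) * (m + n)
4mn≤[m+n]² m n with ≤-total m n
... | inj₁ m≤n with d , refl ← m≤n⇒∃[o]m+o≡n m≤n = subst (4 * (m * (m + d)) ≤_) (sym (square m d)) (m≤m+n _ _)
  where
  square : ∀ m d → (m + (m + d)) * (m + (m + d)) ≡ 4 * (m * (m + d)) + d * d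
  square = solve-∀
... | inj₂ n≤m with d , refl ← m≤n⇒∃[o]m+o≡n n≤m = subst (4 * ((n + d) * n) ≤_) (sym (square n d)) (m≤m+n _ _)
  where
  square : ∀ n d → (n + d + n) * (n + d + n) ≡ 4 * ((n + d) * n) + d * d
  square = solve-∀

[1+m]^k*r≤m^[1+k] : ∀ k m r → r + k ≤ m → suc m ^ k * r ≤ m ^ suc k
[1+m]^k*r≤m^[1+k] zero    m r r≤m = subst₂ _≤_ (sym (*-identityˡ r)) (sym (*-identityʳ m)) (subst (_≤ m) (+-identityʳ r) r≤m)
[1+m]^k*r≤m^[1+k] (suc k) m r r+k+1≤m = begin
  suc m * suc m ^ k * r    ≡⟨ trans (*-assoc (suc m) (suc m ^ k) r) (x∙yz≈y∙xz (suc m) (suc m ^ k) r) ⟩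
  suc m ^ k * (suc m * r)  ≤⟨ *-monoʳ-≤ (suc m ^ k) [1+m]r≤m[1+r] ⟩
  suc m ^ k * (m * suc r)  ≡⟨ x∙yz≈y∙xz (suc m ^ k) m (suc r) ⟩
  m * (suc m ^ k * suc r)  ≤⟨ *-monoʳ-≤ m ([1+m]^k*r≤m^[1+k] k m (suc r) (subst (_≤ m) (+-suc r k) r+k+1≤m)) ⟩
  m * m ^ suc k            ∎
  where
  open ≤-Reasoning
  [1+m]r≤m[1+r] : suc m * r ≤ m * suc r
  [1+m]r≤m[1+r] = subst (suc m * r ≤_) (sym (*-suc m r)) (+-monoˡ-≤ (m * r) (≤-trans (m≤m+n r (suc k)) r+k+1≤m))

a≤b⇒a*b^k+b*a^k≤a^[1+k]+b^[1+k] : ∀ {a b} k → a ≤ b → a * b ^ k + b * a ^ k ≤ a ^ suc k + b ^ suc k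
a≤b⇒a*b^k+b*a^k≤a^[1+k]+b^[1+k] {a} k a≤b
  with d , refl ← m≤n⇒∃[o]m+o≡n a≤b | e , a^k+e≡b^k ← m≤n⇒∃[o]m+o≡n (^-monoˡ-≤ k a≤b) =
  subst (λ z → a * z + (a + d) * a ^ k ≤ a * a ^ k + (a + d) * z) a^k+e≡b^k
    (subst₂ _≤_ (sym (lhs a d (a ^ k) e)) (sym (rhs a d (a ^ k) e)) (m≤m+n _ (d * e)))
  where
  lhs : ∀ x d y e → x * (y + e) + (x + d) * y ≡ x * y + x * y + x * e + d * y
  lhs = solve-∀
  rhs : ∀ x d y e → x * y + (x + d) * (y + e) ≡ x * y + x * y + x * e + d * y + d * e
  rhs = solve-∀

a*b^k+b*a^k≤a^[1+k]+b^[1+k] : ∀ a b k → a * b ^ k + b * a ^ k ≤ a ^ suc k + b ^ suc k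
a*b^k+b*a^k≤a^[1+k]+b^[1+k] a b k with ≤-total a b
... | inj₁ a≤b = a≤b⇒a*b^k+b*a^k≤a^[1+k]+b^[1+k] k a≤b
... | inj₂ b≤a = subst₂ _≤_ (+-comm (b * a ^ k) _) (+-comm (b ^ suc k) _) (a≤b⇒a*b^k+b*a^k≤a^[1+k]+b^[1+k] k b≤a)

∑∑-* : ∀ n (x y : Fin n → ℕ) → ∑[ i < n ] ∑[ j < n ] (x i * y j) ≡ ∑ x * ∑ y
∑∑-* n x y = trans (∑-cong {n} λ i → sym (*-distribˡ-sum (x i) y)) (sym (*-distribʳ-sum (∑ y) x))

chebyshev : ∀ n (x y : Fin n → ℕ) → (∀ i j → x i * y j + x j * y i ≤ x i * y i + x j * y j) →
  ∑ x * ∑ y ≤ n * ∑[ i < n ] (x i * y i)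
chebyshev n x y similarlyOrdered = *-cancelˡ-≤ 2 (begin
  2 * (∑ x * ∑ y)
    ≡⟨ cong (∑ x * ∑ y +_) (+-identityʳ _) ⟩
  ∑ x * ∑ y + ∑ x * ∑ y
    ≡⟨ cong₂ _+_ (∑∑-* n x y) (trans (∑-comm (λ i j → x j * y i)) (∑∑-* n x y)) ⟨
  ∑[ i < n ] ∑[ j < n ] (x i * y j) + ∑[ i < n ] ∑[ j < n ] (x j * y i)
    ≡⟨ ∑∑-distrib-+ (λ i j → x i * y j) (λ i j → x j * y i) ⟨
  ∑[ i < n ] ∑[ j < n ] (x i * y j + x j * y i)
    ≤⟨ ∑-mono-≤ (λ i → ∑-mono-≤ (similarlyOrdered i)) ⟩
  ∑[ i < n ] ∑[ j < n ] (x i * y i + x j * y j)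
    ≡⟨ ∑∑-distrib-+ (λ i j → x i * y i) (λ i j → x j * y j) ⟩
  ∑[ i < n ] ∑[ j < n ] (x i * y i) + ∑[ i < n ] ∑[ j < n ] (x j * y j)
    ≡⟨ cong₂ _+_ (trans (∑-cong {n} λ i → ∑-const n (x i * y i)) (sym (*-distribˡ-sum n xy))) (∑-const n (∑ xy)) ⟩
  n * ∑ xy + n * ∑ xy
    ≡⟨ cong (n * ∑ xy +_) (+-identityʳ _) ⟨
  2 * (n * ∑ xy) ∎)
  where
  open ≤-Reasoning
  xy : Fin n → ℕ
  xy i = x i * y i
  ∑∑-distrib-+ : (f g : Fin n → Fin n → ℕ) →
    ∑[ i < n ] ∑[ j < n ] (f i j + g i j) ≡ ∑[ i < n ] ∑[ j < n ] f i j + ∑[ i < n ] ∑[ j < n ] g i j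
  ∑∑-distrib-+ f g = trans (∑-cong {n} λ i → ∑-distrib-+ (f i) (g i)) (∑-distrib-+ (λ i → ∑ (f i)) (λ i → ∑ (g i)))

power-mean : ∀ n (x : Fin n → ℕ) t → ∑ x ^ suc t ≤ n ^ t * ∑[ i < n ] (x i ^ suc t)
power-mean n x zero = ≤-reflexive (trans (*-identityʳ (∑ x)) (sym (trans (+-identityʳ _) (∑-cong {n} λ i → *-identityʳ (x i)))))
power-mean n x (suc t) = begin
  ∑ x * ∑ x ^ suc t                            ≤⟨ *-monoʳ-≤ (∑ x) (power-mean n x t) ⟩
  ∑ x * (n ^ t * ∑ x^[1+t])                    ≡⟨ x∙yz≈y∙xz (∑ x) (n ^ t) _ ⟩
  n ^ t * (∑ x * ∑ x^[1+t])                    ≤⟨ *-monoʳ-≤ (n ^ t) (chebyshev n x x^[1+t] similarlyOrdered) ⟩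
  n ^ t * (n * ∑[ i < n ] (x i * x^[1+t] i))   ≡⟨ trans (x∙yz≈y∙xz (n ^ t) n _) (sym (*-assoc n (n ^ t) _)) ⟩
  n ^ suc t * ∑[ i < n ] (x i ^ suc (suc t))   ∎
  where
  open ≤-Reasoning
  x^[1+t] : Fin n → ℕ
  x^[1+t] i = x i ^ suc t
  similarlyOrdered : ∀ i j → x i * x^[1+t] j + x j * x^[1+t] i ≤ x i * x^[1+t] i + x j * x^[1+t] j
  similarlyOrdered i j = a*b^k+b*a^k≤a^[1+k]+b^[1+k] (x i) (x j) (suc t)

-- Stars with leaves on one side are Sidorenko, near-balanced stars are anti-Sidorenko

k*[1+m]^[1+t]≤[1+k]*m^[1+t] : ∀ k t m → suc k * suc t ≤ m → k * suc m ^ suc t ≤ suc k * m ^ suc t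
k*[1+m]^[1+t]≤[1+k]*m^[1+t] k t m [1+k][1+t]≤m with e , refl ← m≤n⇒∃[o]m+o≡n [1+k][1+t]≤m = begin
  k * (suc m * suc m ^ t)   ≡⟨ trans (sym (*-assoc k (suc m) (suc m ^ t))) (*-comm (k * suc m) (suc m ^ t)) ⟩
  suc m ^ t * (k * suc m)   ≤⟨ *-monoʳ-≤ (suc m ^ t) (subst (k * suc m ≤_) (sym (expand k t e)) (m≤m+n (k * suc m) (suc e))) ⟩
  suc m ^ t * (suc k * r)   ≡⟨ x∙yz≈y∙xz (suc m ^ t) (suc k) r ⟩
  suc k * (suc m ^ t * r)   ≤⟨ *-monoʳ-≤ (suc k) ([1+m]^k*r≤m^[1+k] t m r (≤-reflexive (r+t≡m k t e))) ⟩
  suc k * m ^ suc t         ∎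
  where
  open ≤-Reasoning
  r = k * suc t + suc e
  r+t≡m : ∀ k t e → k * suc t + suc e + t ≡ suc k * suc t + e
  r+t≡m = solve-∀
  expand : ∀ k t e → suc k * (k * suc t + suc e) ≡ k * suc (suc k * suc t + e) + suc e
  expand = solve-∀

sidorenko-bound : ∀ k t n (x : Fin n → ℕ) → suc k * suc t < n → 2 * ∑ x + n ≡ n * n →
  k * n ^ suc (suc t) ≤ suc k * (∑[ i < n ] (x i ^ suc t) * 2 ^ suc t)
sidorenko-bound k t (suc m) x [1+k][1+t]<n 2∑x+n≡n² = *-cancelˡ-≤ (n ^ t) {{n^t≢0}} (begin
  n ^ t * (k * n ^ suc (suc t))          ≡⟨ regroup n (n ^ t) k ⟩
  n ^ suc t * (k * n ^ suc t)            ≤⟨ *-monoʳ-≤ (n ^ suc t) (k*[1+m]^[1+t]≤[1+k]*m^[1+t] k t m (s≤s⁻¹ [1+k][1+t]<n)) ⟩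
  n ^ suc t * (suc k * m ^ suc t)        ≡⟨ x∙yz≈y∙xz (n ^ suc t) (suc k) (m ^ suc t) ⟩
  suc k * (n ^ suc t * m ^ suc t)        ≡⟨ cong (suc k *_) (^-distribʳ-* n m (suc t)) ⟨
  suc k * (n * m) ^ suc t                ≡⟨ cong (λ z → suc k * z ^ suc t) 2∑x≡nm ⟨
  suc k * (2 * ∑ x) ^ suc t              ≡⟨ cong (suc k *_) (^-distribʳ-* 2 (∑ x) (suc t)) ⟩
  suc k * (2 ^ suc t * ∑ x ^ suc t)      ≤⟨ *-monoʳ-≤ (suc k) (*-monoʳ-≤ (2 ^ suc t) (power-mean n x t)) ⟩
  suc k * (2 ^ suc t * (n ^ t * H))      ≡⟨ regroup′ (suc k) (2 ^ suc t) (n ^ t) H ⟩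
  n ^ t * (suc k * (H * 2 ^ suc t))      ∎)
  where
  open ≤-Reasoning
  n = suc m
  H = ∑[ i < n ] (x i ^ suc t)
  n^t≢0 : NonZero (n ^ t)
  n^t≢0 = m^n≢0 n t
  2∑x≡nm : 2 * ∑ x ≡ n * m
  2∑x≡nm = +-cancelʳ-≡ n (2 * ∑ x) (n * m) (trans 2∑x+n≡n² (trans (*-suc n m) (+-comm n (n * m))))
  regroup : ∀ n p k → p * (k * (n * (n * p))) ≡ n * p * (k * (n * p))
  regroup = solve-∀
  regroup′ : ∀ k q p h → k * (q * (p * h)) ≡ p * (k * (h * q))
  regroup′ = solve-∀

StarSidorenko : ℕ → ℕ → Set
StarSidorenko a b = ∀ k → ∃ λ N → ∀ n → n ≥ N → (τ : Tournament n) →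
  k * n ^ suc (a + b) ≤ suc k * (degreeMoment τ a b * 2 ^ (a + b))

StarAntiSidorenko : ℕ → ℕ → Set
StarAntiSidorenko a b = ∀ n → n ≥ 1 → (τ : Tournament n) →
  degreeMoment τ a b * 2 ^ (a + b) ≤ n ^ suc (a + b)

starSidorenko-out : ∀ b → StarSidorenko 0 b
starSidorenko-out zero k = 0 , λ n _ τ → begin
  k * n ^ 1                       ≤⟨ *-monoˡ-≤ (n ^ 1) (n≤1+n k) ⟩
  suc k * (n * 1)                 ≡⟨ cong (λ h → suc k * (h * 1)) (trans (∑-const n 1) (*-identityʳ n)) ⟨
  suc k * (degreeMoment τ 0 0 * 1) ∎
  where open ≤-Reasoning
starSidorenko-out (suc t) k = suc (suc k * suc t) , λ n n>[1+k][1+t] τ →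
  subst (λ h → k * n ^ suc (suc t) ≤ suc k * (h * 2 ^ suc t)) (∑-cong {n} λ v → sym (*-identityˡ _))
    (sidorenko-bound k t n (outdeg τ) n>[1+k][1+t] (2∑outdeg+n≡n² τ))

starSidorenko-in : ∀ a → StarSidorenko a 0
starSidorenko-in zero = starSidorenko-out zero
starSidorenko-in (suc t) k = suc (suc k * suc t) , λ n n>[1+k][1+t] τ →
  subst (λ a → k * n ^ suc a ≤ suc k * (degreeMoment τ (suc t) 0 * 2 ^ a)) (sym (+-identityʳ (suc t)))
    (subst (λ h → k * n ^ suc (suc t) ≤ suc k * (h * 2 ^ suc t)) (∑-cong {n} λ v → sym (*-identityʳ _))
      (sidorenko-bound k t n (indeg τ) n>[1+k][1+t] (2∑indeg+n≡n² τ)))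

m^[n+n]≡[m*m]^n : ∀ m n → m ^ (n + n) ≡ (m * m) ^ n
m^[n+n]≡[m*m]^n m n = trans (^-distribˡ-+-* m n n) (sym (^-distribʳ-* m m n))

x^c*y^c*2^[c+c]≡[4xy]^c : ∀ x y c → x ^ c * y ^ c * 2 ^ (c + c) ≡ (4 * (x * y)) ^ c
x^c*y^c*2^[c+c]≡[4xy]^c x y c = begin
  x ^ c * y ^ c * 2 ^ (c + c)   ≡⟨ cong₂ _*_ (sym (^-distribʳ-* x y c)) (m^[n+n]≡[m*m]^n 2 c) ⟩
  (x * y) ^ c * 4 ^ c           ≡⟨ *-comm ((x * y) ^ c) (4 ^ c) ⟩
  4 ^ c * (x * y) ^ c           ≡⟨ ^-distribʳ-* 4 (x * y) c ⟨
  (4 * (x * y)) ^ c             ∎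
  where open ≡-Reasoning

4*indeg*outdeg≤n² : ∀ {n} (τ : Tournament n) v → 4 * (indeg τ v * outdeg τ v) ≤ n * n
4*indeg*outdeg≤n² τ v = ≤-trans (4mn≤[m+n]² (indeg τ v) (outdeg τ v)) (*-mono-≤ (indeg+outdeg≤ τ v) (indeg+outdeg≤ τ v))

degreeMoment-balanced : ∀ {n} (τ : Tournament n) c → degreeMoment τ c c * 2 ^ (c + c) ≤ n ^ suc (c + c)
degreeMoment-balanced {n} τ c = begin
  degreeMoment τ c c * 2 ^ (c + c)
    ≡⟨ *-distribʳ-sum (2 ^ (c + c)) (λ v → indeg τ v ^ c * outdeg τ v ^ c) ⟩
  ∑[ v < n ] (indeg τ v ^ c * outdeg τ v ^ c * 2 ^ (c + c))
    ≡⟨ ∑-cong {n} (λ v → x^c*y^c*2^[c+c]≡[4xy]^c (indeg τ v) (outdeg τ v) c) ⟩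
  ∑[ v < n ] ((4 * (indeg τ v * outdeg τ v)) ^ c)
    ≤⟨ ∑-mono-≤ (λ v → ^-monoˡ-≤ c (4*indeg*outdeg≤n² τ v)) ⟩
  ∑[ v < n ] ((n * n) ^ c)
    ≡⟨ ∑-const n ((n * n) ^ c) ⟩
  n * (n * n) ^ c
    ≡⟨ cong (n *_) (m^[n+n]≡[m*m]^n n c) ⟨
  n ^ suc (c + c) ∎
  where open ≤-Reasoning

∑-2*weight*bounded : ∀ n c (w g : Fin n → ℕ) → 2 * ∑ w + n ≡ n * n → (∀ v → g v ≤ (n * n) ^ c) →
  ∑[ v < n ] (2 * w v * g v) ≤ n ^ suc (suc (c + c))
∑-2*weight*bounded n c w g 2∑w+n≡n² g≤ = begin
  ∑[ v < n ] (2 * w v * g v)            ≤⟨ ∑-mono-≤ (λ v → *-monoʳ-≤ (2 * w v) (g≤ v)) ⟩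
  ∑[ v < n ] (2 * w v * (n * n) ^ c)    ≡⟨ *-distribʳ-sum ((n * n) ^ c) (λ v → 2 * w v) ⟨
  ∑[ v < n ] (2 * w v) * (n * n) ^ c    ≡⟨ cong (_* (n * n) ^ c) (*-distribˡ-sum 2 w) ⟨
  2 * ∑ w * (n * n) ^ c                 ≤⟨ *-monoˡ-≤ ((n * n) ^ c) (subst (2 * ∑ w ≤_) 2∑w+n≡n² (m≤m+n _ n)) ⟩
  n * n * (n * n) ^ c                   ≡⟨ cong (n * n *_) (m^[n+n]≡[m*m]^n n c) ⟨
  n * n * n ^ (c + c)                   ≡⟨ *-assoc n n _ ⟩
  n ^ suc (suc (c + c))                 ∎
  where open ≤-Reasoning

degreeMoment-indeg-heavy : ∀ {n} (τ : Tournament n) c →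
  degreeMoment τ (suc c) c * 2 ^ (suc c + c) ≤ n ^ suc (suc c + c)
degreeMoment-indeg-heavy {n} τ c = begin
  degreeMoment τ (suc c) c * 2 ^ (suc c + c)
    ≡⟨ *-distribʳ-sum (2 ^ (suc c + c)) (λ v → indeg τ v ^ suc c * outdeg τ v ^ c) ⟩
  ∑[ v < n ] (indeg τ v ^ suc c * outdeg τ v ^ c * 2 ^ (suc c + c))
    ≡⟨ ∑-cong {n} (λ v → trans (regroup (indeg τ v) (indeg τ v ^ c) (outdeg τ v ^ c) (2 ^ (c + c)))
                                (cong (2 * indeg τ v *_) (x^c*y^c*2^[c+c]≡[4xy]^c (indeg τ v) (outdeg τ v) c))) ⟩
  ∑[ v < n ] (2 * indeg τ v * (4 * (indeg τ v * outdeg τ v)) ^ c)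
    ≤⟨ ∑-2*weight*bounded n c (indeg τ) _ (2∑indeg+n≡n² τ) (λ v → ^-monoˡ-≤ c (4*indeg*outdeg≤n² τ v)) ⟩
  n ^ suc (suc c + c) ∎
  where
  open ≤-Reasoning
  regroup : ∀ x p q r → x * p * q * (2 * r) ≡ 2 * x * (p * q * r)
  regroup = solve-∀

degreeMoment-outdeg-heavy : ∀ {n} (τ : Tournament n) c →
  degreeMoment τ c (suc c) * 2 ^ (c + suc c) ≤ n ^ suc (c + suc c)
degreeMoment-outdeg-heavy {n} τ c = begin
  degreeMoment τ c (suc c) * 2 ^ (c + suc c)
    ≡⟨ cong (λ e → degreeMoment τ c (suc c) * 2 ^ e) (+-suc c c) ⟩
  degreeMoment τ c (suc c) * 2 ^ (suc c + c)
    ≡⟨ *-distribʳ-sum (2 ^ (suc c + c)) (λ v → indeg τ v ^ c * outdeg τ v ^ suc c) ⟩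
  ∑[ v < n ] (indeg τ v ^ c * outdeg τ v ^ suc c * 2 ^ (suc c + c))
    ≡⟨ ∑-cong {n} (λ v → trans (regroup (outdeg τ v) (indeg τ v ^ c) (outdeg τ v ^ c) (2 ^ (c + c)))
                                (cong (2 * outdeg τ v *_) (x^c*y^c*2^[c+c]≡[4xy]^c (indeg τ v) (outdeg τ v) c))) ⟩
  ∑[ v < n ] (2 * outdeg τ v * (4 * (indeg τ v * outdeg τ v)) ^ c)
    ≤⟨ ∑-2*weight*bounded n c (outdeg τ) _ (2∑outdeg+n≡n² τ) (λ v → ^-monoˡ-≤ c (4*indeg*outdeg≤n² τ v)) ⟩
  n ^ suc (suc c + c)
    ≡⟨ cong (λ e → n ^ suc e) (+-suc c c) ⟨
  n ^ suc (c + suc c) ∎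
  where
  open ≤-Reasoning
  regroup : ∀ y p q r → p * (y * q) * (2 * r) ≡ 2 * y * (p * q * r)
  regroup = solve-∀

starAntiSidorenko-balanced : ∀ a b → a ≤ suc b → b ≤ suc a → StarAntiSidorenko a b
starAntiSidorenko-balanced a b a≤1+b b≤1+a n _ τ with <-cmp a b
... | tri≈ _ refl _ = degreeMoment-balanced τ a
... | tri< a<b _ _ with refl ← ≤-antisym b≤1+a a<b = degreeMoment-outdeg-heavy τ a
... | tri> _ _ b<a with refl ← ≤-antisym a≤1+b b<a = degreeMoment-indeg-heavy τ b

-- A transitive chain beating a rotational tournament

<⇒<ᵇ≡true : ∀ {m n} → m < n → (m <ᵇ n) ≡ true
<⇒<ᵇ≡true {zero}  {suc n} _         = refl
<⇒<ᵇ≡true {suc m} {suc n} (s≤s m<n) = <⇒<ᵇ≡true m<n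

≤⇒<ᵇ≡false : ∀ {m n} → n ≤ m → (m <ᵇ n) ≡ false
≤⇒<ᵇ≡false {m}     {zero}  _         = refl
≤⇒<ᵇ≡false {suc m} {suc n} (s≤s n≤m) = ≤⇒<ᵇ≡false n≤m

<ᵇ≡false⇒≤ : ∀ m n → (m <ᵇ n) ≡ false → n ≤ m
<ᵇ≡false⇒≤ m       zero    _  = z≤n
<ᵇ≡false⇒≤ (suc m) (suc n) eq = s≤s (<ᵇ≡false⇒≤ m n eq)

<ᵇ-asym : ∀ m n → m ≢ n → (m <ᵇ n) ≡ not (n <ᵇ m)
<ᵇ-asym m n m≢n with <-cmp m n
... | tri< m<n _ _ rewrite <⇒<ᵇ≡true m<n | ≤⇒<ᵇ≡false (<⇒≤ m<n) = refl
... | tri≈ _ m≡n _ = contradiction m≡n m≢n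
... | tri> _ _ n<m rewrite <⇒<ᵇ≡true n<m | ≤⇒<ᵇ≡false (<⇒≤ n<m) = refl

sumBelow : ℕ → (ℕ → ℕ) → ℕ
sumBelow zero    f = 0
sumBelow (suc n) f = f 0 + sumBelow n (f ∘ suc)

∑-toℕ : ∀ n (f : ℕ → ℕ) → ∑[ i < n ] f (toℕ i) ≡ sumBelow n f
∑-toℕ zero    f = refl
∑-toℕ (suc n) f = cong (f 0 +_) (∑-toℕ n (f ∘ suc))

sumBelow-cong : ∀ n {f g : ℕ → ℕ} → (∀ x → x < n → f x ≡ g x) → sumBelow n f ≡ sumBelow n g
sumBelow-cong zero    f≗g = refl
sumBelow-cong (suc n) f≗g = cong₂ _+_ (f≗g 0 z<s) (sumBelow-cong n (λ x x<n → f≗g (suc x) (s<s x<n)))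

sumBelow-const : ∀ n c {f : ℕ → ℕ} → (∀ x → x < n → f x ≡ c) → sumBelow n f ≡ n * c
sumBelow-const zero    c f≡c = refl
sumBelow-const (suc n) c f≡c = cong₂ _+_ (f≡c 0 z<s) (sumBelow-const n c (λ x x<n → f≡c (suc x) (s<s x<n)))

sumBelow-mono-≤ : ∀ n {f g : ℕ → ℕ} → (∀ x → x < n → f x ≤ g x) → sumBelow n f ≤ sumBelow n g
sumBelow-mono-≤ zero    f≤g = z≤n
sumBelow-mono-≤ (suc n) f≤g = +-mono-≤ (f≤g 0 z<s) (sumBelow-mono-≤ n (λ x x<n → f≤g (suc x) (s<s x<n)))

sumBelow-+ : ∀ m n f → sumBelow (m + n) f ≡ sumBelow m f + sumBelow n (λ x → f (m + x))
sumBelow-+ zero    n f = refl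
sumBelow-+ (suc m) n f = trans (cong (f 0 +_) (sumBelow-+ m n (f ∘ suc))) (sym (+-assoc (f 0) _ _))

sumBelow-⟦⟧≤ : ∀ n (p : ℕ → Bool) → sumBelow n (λ x → ⟦ p x ⟧) ≤ n
sumBelow-⟦⟧≤ n p = subst (_≤ n) (∑-toℕ n (λ x → ⟦ p x ⟧)) (∑-⟦⟧≤ (λ i → p (toℕ i)))

sumBelow-snoc : ∀ n f → sumBelow (suc n) f ≡ sumBelow n f + f n
sumBelow-snoc zero    f = +-comm (f 0) 0
sumBelow-snoc (suc n) f = trans (cong (f 0 +_) (sumBelow-snoc n (f ∘ suc))) (sym (+-assoc (f 0) _ _))

-- x → y iff y − x ∈ {1, …, k} modulo 2k + 1.
rotationalE : ℕ → ℕ → ℕ → Bool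
rotationalE k x y = if x <ᵇ y then not (k <ᵇ (y ∸ x)) else k <ᵇ (x ∸ y)

rotationalE-irrefl : ∀ k x → rotationalE k x x ≡ false
rotationalE-irrefl k x rewrite ≤⇒<ᵇ≡false {x} {x} ≤-refl | n∸n≡0 x = refl

rotationalE-complete : ∀ k x y → x ≢ y → rotationalE k x y ≡ not (rotationalE k y x)
rotationalE-complete k x y x≢y with <-cmp x y
... | tri< x<y _ _ rewrite <⇒<ᵇ≡true x<y | ≤⇒<ᵇ≡false (<⇒≤ x<y) = refl
... | tri≈ _ x≡y _ = contradiction x≡y x≢y
... | tri> _ _ y<x rewrite <⇒<ᵇ≡true y<x | ≤⇒<ᵇ≡false (<⇒≤ y<x) = sym (not-involutive _)

rotationalOutdeg : ℕ → ℕ → ℕ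
rotationalOutdeg k x = sumBelow (suc (k + k)) (λ y → ⟦ rotationalE k x y ⟧)

-- Shifting both endpoints by one preserves edges, so only the wrap-around term changes.
rotationalOutdeg-suc : ∀ k x → x < k + k → rotationalOutdeg k (suc x) ≡ rotationalOutdeg k x
rotationalOutdeg-suc k x x<2k = begin
  ⟦ k <ᵇ suc x ⟧ + sumBelow (k + k) (λ y → ⟦ rotationalE k x y ⟧)
    ≡⟨ +-comm ⟦ k <ᵇ suc x ⟧ _ ⟩
  sumBelow (k + k) (λ y → ⟦ rotationalE k x y ⟧) + ⟦ k <ᵇ suc x ⟧
    ≡⟨ cong (λ b → sumBelow (k + k) (λ y → ⟦ rotationalE k x y ⟧) + ⟦ b ⟧) wrapsAround ⟨
  sumBelow (k + k) (λ y → ⟦ rotationalE k x y ⟧) + ⟦ rotationalE k x (k + k) ⟧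
    ≡⟨ sumBelow-snoc (k + k) (λ y → ⟦ rotationalE k x y ⟧) ⟨
  rotationalOutdeg k x ∎
  where
  open ≡-Reasoning
  wrapsAround : rotationalE k x (k + k) ≡ (k <ᵇ suc x)
  wrapsAround rewrite <⇒<ᵇ≡true x<2k with k ≤? x
  ... | yes k≤x rewrite ≤⇒<ᵇ≡false (m≤n+o⇒m∸n≤o (k + k) x (+-monoˡ-≤ k k≤x)) | <⇒<ᵇ≡true (s≤s k≤x) = refl
  ... | no  k≰x with ≰⇒> k≰x
  ...   | x<k rewrite <⇒<ᵇ≡true (subst (k <_) (sym (+-∸-assoc k (<⇒≤ x<k))) (m<m+n k (m<n⇒0<n∸m x<k)))
                    | ≤⇒<ᵇ≡false {k} {suc x} x<k = refl

rotationalOutdeg-zero : ∀ k → rotationalOutdeg k 0 ≡ k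
rotationalOutdeg-zero k = begin
  sumBelow (k + k) (λ y → ⟦ not (k <ᵇ suc y) ⟧)
    ≡⟨ sumBelow-+ k k _ ⟩
  sumBelow k (λ y → ⟦ not (k <ᵇ suc y) ⟧) + sumBelow k (λ y → ⟦ not (k <ᵇ suc (k + y)) ⟧)
    ≡⟨ cong₂ _+_ (sumBelow-const k 1 (λ y y<k → cong (⟦_⟧ ∘ not) (≤⇒<ᵇ≡false y<k)))
                 (sumBelow-const k 0 (λ y _ → cong (⟦_⟧ ∘ not) (<⇒<ᵇ≡true (s≤s (m≤m+n k y))))) ⟩
  k * 1 + k * 0
    ≡⟨ cong₂ _+_ (*-identityʳ k) (*-zeroʳ k) ⟩
  k + 0
    ≡⟨ +-identityʳ k ⟩
  k ∎
  where open ≡-Reasoning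

rotationalOutdeg≡k : ∀ k x → x ≤ k + k → rotationalOutdeg k x ≡ k
rotationalOutdeg≡k k zero    _     = rotationalOutdeg-zero k
rotationalOutdeg≡k k (suc x) x<2k = trans (rotationalOutdeg-suc k x x<2k) (rotationalOutdeg≡k k x (<⇒≤ x<2k))

-- The vertices below p form a transitive tournament and beat all vertices p, …, p + 2k, which
-- carry the rotational tournament.
chainOverRotationalE : ℕ → ℕ → ℕ → ℕ → Bool
chainOverRotationalE p k u v =
  if u <ᵇ p then (if v <ᵇ p then u <ᵇ v else true)
  else (if v <ᵇ p then false else rotationalE k (u ∸ p) (v ∸ p))

chainOverRotationalE-irrefl : ∀ p k u → chainOverRotationalE p k u u ≡ false
chainOverRotationalE-irrefl p k u with u <ᵇ p
... | true  = ≤⇒<ᵇ≡false {u} {u} ≤-refl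
... | false = rotationalE-irrefl k (u ∸ p)

chainOverRotationalE-complete : ∀ p k u v → u ≢ v →
  chainOverRotationalE p k u v ≡ not (chainOverRotationalE p k v u)
chainOverRotationalE-complete p k u v u≢v with u <ᵇ p in u<ᵇp | v <ᵇ p in v<ᵇp
... | true  | true  = <ᵇ-asym u v u≢v
... | true  | false = refl
... | false | true  = refl
... | false | false = rotationalE-complete k (u ∸ p) (v ∸ p)
  (u≢v ∘ ∸-cancelʳ-≡ (<ᵇ≡false⇒≤ u p u<ᵇp) (<ᵇ≡false⇒≤ v p v<ᵇp))

ChainOverRotational : ∀ p k → Tournament (p + suc (k + k))
ChainOverRotational p k = record
  { T        = λ u v → chainOverRotationalE p k (toℕ u) (toℕ v)
  ; irrefl   = λ u → chainOverRotationalE-irrefl p k (toℕ u)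
  ; complete = λ u v u≢v → chainOverRotationalE-complete p k (toℕ u) (toℕ v) (u≢v ∘ toℕ-injective)
  }

converse : ∀ {n} → Tournament n → Tournament n
converse τ = record
  { T        = λ u v → T τ v u
  ; irrefl   = irrefl τ
  ; complete = λ u v u≢v → complete τ v u (u≢v ∘ sym)
  }

degreeMoment-converse : ∀ {n} (τ : Tournament n) a b → degreeMoment (converse τ) a b ≡ degreeMoment τ b a
degreeMoment-converse {n} τ a b = ∑-cong {n} λ v → *-comm (outdeg τ v ^ a) (indeg τ v ^ b)

chainIn chainOut : ℕ → ℕ → ℕ → ℕ
chainIn  p k w = sumBelow (p + suc (k + k)) (λ u → ⟦ chainOverRotationalE p k u w ⟧)
chainOut p k w = sumBelow (p + suc (k + k)) (λ u → ⟦ chainOverRotationalE p k w u ⟧)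

chainOut-rotational : ∀ p k x → x ≤ k + k → chainOut p k (p + x) ≡ k
chainOut-rotational p k x x≤2k = begin
  chainOut p k (p + x)
    ≡⟨ sumBelow-+ p (suc (k + k)) edgeTo ⟩
  sumBelow p edgeTo + sumBelow (suc (k + k)) (λ y → edgeTo (p + y))
    ≡⟨ cong₂ _+_ (sumBelow-const p 0 toChain) (sumBelow-cong (suc (k + k)) toRotational) ⟩
  p * 0 + rotationalOutdeg k x
    ≡⟨ cong₂ _+_ (*-zeroʳ p) (rotationalOutdeg≡k k x x≤2k) ⟩
  k ∎
  where
  open ≡-Reasoning
  edgeTo : ℕ → ℕ
  edgeTo u = ⟦ chainOverRotationalE p k (p + x) u ⟧
  p+x≮p : (p + x <ᵇ p) ≡ false
  p+x≮p = ≤⇒<ᵇ≡false (m≤m+n p x)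
  toChain : ∀ u → u < p → edgeTo u ≡ 0
  toChain u u<p rewrite p+x≮p | <⇒<ᵇ≡true u<p = refl
  toRotational : ∀ y → y < suc (k + k) → edgeTo (p + y) ≡ ⟦ rotationalE k x y ⟧
  toRotational y _ rewrite p+x≮p | ≤⇒<ᵇ≡false {p + y} {p} (m≤m+n p y) | m+n∸m≡n p x | m+n∸m≡n p y = refl

chainIn-chain : ∀ p k w → w < p → chainIn p k w ≤ p
chainIn-chain p k w w<p = begin
  chainIn p k w
    ≡⟨ sumBelow-+ p (suc (k + k)) edgeFrom ⟩
  sumBelow p edgeFrom + sumBelow (suc (k + k)) (λ y → edgeFrom (p + y))
    ≡⟨ cong (sumBelow p edgeFrom +_) (sumBelow-const (suc (k + k)) 0 fromRotational) ⟩
  sumBelow p edgeFrom + suc (k + k) * 0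
    ≡⟨ trans (cong (sumBelow p edgeFrom +_) (*-zeroʳ (suc (k + k)))) (+-identityʳ _) ⟩
  sumBelow p edgeFrom
    ≤⟨ sumBelow-⟦⟧≤ p (λ u → chainOverRotationalE p k u w) ⟩
  p ∎
  where
  open ≤-Reasoning
  edgeFrom : ℕ → ℕ
  edgeFrom u = ⟦ chainOverRotationalE p k u w ⟧
  fromRotational : ∀ y → y < suc (k + k) → edgeFrom (p + y) ≡ 0
  fromRotational y _ rewrite ≤⇒<ᵇ≡false {p + y} {p} (m≤m+n p y) | <⇒<ᵇ≡true w<p = refl

indeg-ChainOverRotational : ∀ p k v → indeg (ChainOverRotational p k) v ≡ chainIn p k (toℕ v)
indeg-ChainOverRotational p k v = ∑-toℕ (p + suc (k + k)) (λ u → ⟦ chainOverRotationalE p k u (toℕ v) ⟧)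

outdeg-ChainOverRotational : ∀ p k v → outdeg (ChainOverRotational p k) v ≡ chainOut p k (toℕ v)
outdeg-ChainOverRotational p k v = ∑-toℕ (p + suc (k + k)) (λ u → ⟦ chainOverRotationalE p k (toℕ v) u ⟧)

chainIn-rotational : ∀ p k x → x ≤ k + k → chainIn p k (p + x) ≡ p + k
chainIn-rotational p k x x≤2k = suc-injective (+-cancelʳ-≡ k _ _ (begin
  suc (chainIn p k (p + x)) + k
    ≡⟨ cong (λ o → suc (chainIn p k (p + x) + o)) (chainOut-rotational p k x x≤2k) ⟨
  suc (chainIn p k (p + x) + chainOut p k (p + x))
    ≡⟨ cong (λ w → suc (chainIn p k w + chainOut p k w)) (toℕ-fromℕ< p+x<n) ⟨
  suc (chainIn p k (toℕ v) + chainOut p k (toℕ v))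
    ≡⟨ cong suc (cong₂ _+_ (indeg-ChainOverRotational p k v) (outdeg-ChainOverRotational p k v)) ⟨
  suc (indeg τ v + outdeg τ v)
    ≡⟨ indeg+outdeg τ v ⟩
  p + suc (k + k)
    ≡⟨ p+[1+[k+k]]≡1+[p+k]+k p k ⟩
  suc (p + k) + k ∎))
  where
  open ≡-Reasoning
  τ = ChainOverRotational p k
  p+x<n : p + x < p + suc (k + k)
  p+x<n = +-monoʳ-< p (s≤s x≤2k)
  v = fromℕ< p+x<n
  p+[1+[k+k]]≡1+[p+k]+k : ∀ p k → p + suc (k + k) ≡ suc (p + k) + k
  p+[1+[k+k]]≡1+[p+k]+k = solve-∀

degreeMoment-ChainOverRotational : ∀ p k a b →
  degreeMoment (ChainOverRotational p k) a b
    ≡ sumBelow p (λ w → chainIn p k w ^ a * chainOut p k w ^ b) + suc (k + k) * ((p + k) ^ a * k ^ b)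
degreeMoment-ChainOverRotational p k a b = begin
  degreeMoment (ChainOverRotational p k) a b
    ≡⟨ ∑-cong {n} (λ v → cong₂ (λ i o → i ^ a * o ^ b) (indeg-ChainOverRotational p k v)
                                                      (outdeg-ChainOverRotational p k v)) ⟩
  ∑[ v < n ] moment (toℕ v)
    ≡⟨ ∑-toℕ n moment ⟩
  sumBelow n moment
    ≡⟨ sumBelow-+ p (suc (k + k)) moment ⟩
  sumBelow p moment + sumBelow (suc (k + k)) (λ x → moment (p + x))
    ≡⟨ cong (sumBelow p moment +_) (sumBelow-const (suc (k + k)) _ λ x x<1+2k →
         cong₂ (λ i o → i ^ a * o ^ b) (chainIn-rotational p k x (s≤s⁻¹ x<1+2k))
                                       (chainOut-rotational p k x (s≤s⁻¹ x<1+2k))) ⟩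
  sumBelow p moment + suc (k + k) * ((p + k) ^ a * k ^ b) ∎
  where
  open ≡-Reasoning
  n = p + suc (k + k)
  moment : ℕ → ℕ
  moment w = chainIn p k w ^ a * chainOut p k w ^ b

degreeMoment-ChainOverRotational-≤ : ∀ p k a b →
  degreeMoment (ChainOverRotational p k) a b
    ≤ p * (p ^ a * (p + suc (k + k)) ^ b) + suc (k + k) * ((p + k) ^ a * k ^ b)
degreeMoment-ChainOverRotational-≤ p k a b = begin
  degreeMoment (ChainOverRotational p k) a b
    ≡⟨ degreeMoment-ChainOverRotational p k a b ⟩
  sumBelow p moment + rotationalPart
    ≤⟨ +-monoˡ-≤ rotationalPart (sumBelow-mono-≤ p λ w w<p →
         *-mono-≤ (^-monoˡ-≤ a (chainIn-chain p k w w<p)) (^-monoˡ-≤ b (sumBelow-⟦⟧≤ n (chainOverRotationalE p k w)))) ⟩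
  sumBelow p (λ _ → p ^ a * n ^ b) + rotationalPart
    ≡⟨ cong (_+ rotationalPart) (sumBelow-const p (p ^ a * n ^ b) (λ _ _ → refl)) ⟩
  p * (p ^ a * n ^ b) + rotationalPart ∎
  where
  open ≤-Reasoning
  n = p + suc (k + k)
  moment : ℕ → ℕ
  moment w = chainIn p k w ^ a * chainOut p k w ^ b
  rotationalPart = suc (k + k) * ((p + k) ^ a * k ^ b)

degreeMoment-ChainOverRotational-≥ : ∀ p k a b →
  suc (k + k) * ((p + k) ^ a * k ^ b) ≤ degreeMoment (ChainOverRotational p k) a b
degreeMoment-ChainOverRotational-≥ p k a b =
  subst (suc (k + k) * ((p + k) ^ a * k ^ b) ≤_) (sym (degreeMoment-ChainOverRotational p k a b))
    (m≤n+m _ (sumBelow p (λ w → chainIn p k w ^ a * chainOut p k w ^ b)))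

-- Stars with leaves on both sides are not Sidorenko

q*w+x≤q*x⇒[1+q]*w<q*x : ∀ q x w → 1 ≤ x → q * w + x ≤ q * x → suc q * w < q * x
q*w+x≤q*x⇒[1+q]*w<q*x q x w 1≤x qw+x≤qx = *-cancelˡ-< q _ _ (<-≤-trans (m<m+n _ 1≤x) (+-cancelʳ-≤ (q * x) _ _ (begin
  q * (suc q * w) + x + q * x   ≡⟨ expand q x w ⟩
  suc q * (q * w + x)           ≤⟨ *-monoʳ-≤ (suc q) qw+x≤qx ⟩
  suc q * (q * x)               ≡⟨ expand′ q x ⟩
  q * (q * x) + q * x           ∎)))
  where
  open ≤-Reasoning
  expand : ∀ q x w → q * (suc q * w) + x + q * x ≡ suc q * (q * w + x)
  expand = solve-∀
  expand′ : ∀ q x → suc q * (q * x) ≡ q * (q * x) + q * x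
  expand′ = solve-∀

t*p≤n⇒t*[p*[p^[1+a]*n^b]]≤p*n^[1+a+b] : ∀ t a b p n → t * p ≤ n → p ≤ n →
  t * (p * (p ^ suc a * n ^ b)) ≤ p * n ^ (suc a + b)
t*p≤n⇒t*[p*[p^[1+a]*n^b]]≤p*n^[1+a+b] t a b p n tp≤n p≤n = begin
  t * (p * (p * p ^ a * n ^ b))   ≡⟨ regroup t p (p ^ a) (n ^ b) ⟩
  p * (t * p * p ^ a * n ^ b)     ≤⟨ *-monoʳ-≤ p (*-monoˡ-≤ (n ^ b) (*-mono-≤ tp≤n (^-monoˡ-≤ a p≤n))) ⟩
  p * (n * n ^ a * n ^ b)         ≡⟨ cong (p *_) (^-distribˡ-+-* n (suc a) b) ⟨
  p * n ^ (suc a + b)             ∎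
  where
  open ≤-Reasoning
  regroup : ∀ t p x y → t * (p * (p * x * y)) ≡ p * (t * p * x * y)
  regroup = solve-∀

2^s*[p+k]^a*k^[a+c]≤n^s : ∀ a c p k n → p + (k + k) ≤ n →
  2 ^ (a + (a + c)) * ((p + k) ^ a * k ^ (a + c)) ≤ n ^ (a + (a + c))
2^s*[p+k]^a*k^[a+c]≤n^s a c p k n p+2k≤n = begin
  2 ^ (a + (a + c)) * ((p + k) ^ a * k ^ (a + c))
    ≡⟨ cong₂ _*_ (trans (^-distribˡ-+-* 2 a (a + c)) (cong (2 ^ a *_) (^-distribˡ-+-* 2 a c)))
                 (cong ((p + k) ^ a *_) (^-distribˡ-+-* k a c)) ⟩
  2 ^ a * (2 ^ a * 2 ^ c) * ((p + k) ^ a * (k ^ a * k ^ c))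
    ≡⟨ regroup (2 ^ a) (2 ^ c) ((p + k) ^ a) (k ^ a) (k ^ c) ⟩
  (2 ^ a * (p + k) ^ a) * (2 ^ a * k ^ a) * (2 ^ c * k ^ c)
    ≡⟨ cong₂ _*_ (trans (^-distribʳ-* (2 * (p + k)) (2 * k) a) (cong₂ _*_ (^-distribʳ-* 2 (p + k) a) (^-distribʳ-* 2 k a)))
                 (^-distribʳ-* 2 k c) ⟨
  (2 * (p + k) * (2 * k)) ^ a * (2 * k) ^ c
    ≤⟨ *-mono-≤ (^-monoˡ-≤ a 4[p+k]k≤n²) (^-monoˡ-≤ c 2k≤n) ⟩
  (n * n) ^ a * n ^ c
    ≡⟨ cong (_* n ^ c) (m^[n+n]≡[m*m]^n n a) ⟨
  n ^ (a + a) * n ^ c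
    ≡⟨ trans (sym (^-distribˡ-+-* n (a + a) c)) (cong (n ^_) (+-assoc a a c)) ⟩
  n ^ (a + (a + c)) ∎
  where
  open ≤-Reasoning
  regroup : ∀ x y z u v → x * (x * y) * (z * (u * v)) ≡ (x * z) * (x * u) * (y * v)
  regroup = solve-∀
  2k≤n : 2 * k ≤ n
  2k≤n = ≤-trans (≤-reflexive (cong (k +_) (+-identityʳ k))) (≤-trans (m≤n+m (k + k) p) p+2k≤n)
  4[p+k]k≤n² : 2 * (p + k) * (2 * k) ≤ n * n
  4[p+k]k≤n² = ≤-trans (subst (2 * (p + k) * (2 * k) ≤_) (square p k) (m≤n+m _ (p * p))) (*-mono-≤ p+2k≤n p+2k≤n)
    where
    square : ∀ p k → p * p + 2 * (p + k) * (2 * k) ≡ (p + (k + k)) * (p + (k + k))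
    square = solve-∀

chainOverRotational-deficit : ∀ a c p k →
  let s = suc a + (suc a + c); m = suc (k + k); n = p + m in
  2 * 2 ^ s * p ≤ n →
  2 * (2 ^ s * (p * (p ^ suc a * n ^ (suc a + c)) + m * ((p + k) ^ suc a * k ^ (suc a + c)))) + p * n ^ s
    ≤ 2 * n ^ suc s
chainOverRotational-deficit a c p k 2·2^s·p≤n = begin
  2 * (2 ^ s * (chainPart + m * rotationalPart)) + p * n ^ s
    ≡⟨ regroup (2 ^ s) chainPart m rotationalPart (p * n ^ s) ⟩
  2 * 2 ^ s * chainPart + 2 * m * (2 ^ s * rotationalPart) + p * n ^ s
    ≤⟨ +-monoˡ-≤ (p * n ^ s) (+-mono-≤ chainBound (*-monoʳ-≤ (2 * m) rotationalBound)) ⟩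
  p * n ^ s + 2 * m * n ^ s + p * n ^ s
    ≡⟨ collect p m (n ^ s) ⟩
  2 * n ^ suc s ∎
  where
  open ≤-Reasoning
  b = suc a + c
  s = suc a + b
  m = suc (k + k)
  n = p + m
  chainPart = p * (p ^ suc a * n ^ b)
  rotationalPart = (p + k) ^ suc a * k ^ b
  chainBound : 2 * 2 ^ s * chainPart ≤ p * n ^ s
  chainBound = t*p≤n⇒t*[p*[p^[1+a]*n^b]]≤p*n^[1+a+b] (2 * 2 ^ s) a b p n 2·2^s·p≤n (m≤m+n p m)
  rotationalBound : 2 ^ s * rotationalPart ≤ n ^ s
  rotationalBound = 2^s*[p+k]^a*k^[a+c]≤n^s (suc a) c p k n (+-monoʳ-≤ p (n≤1+n (k + k)))
  regroup : ∀ t x m y z → 2 * (t * (x + m * y)) + z ≡ 2 * t * x + 2 * m * (t * y) + z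
  regroup = solve-∀
  collect : ∀ p m x → p * x + 2 * m * x + p * x ≡ 2 * ((p + m) * x)
  collect = solve-∀

p+[1+[t*p+t*p]]≤4*t*p : ∀ t p → 1 ≤ t → 1 ≤ p → p + suc (t * p + t * p) ≤ 4 * t * p
p+[1+[t*p+t*p]]≤4*t*p (suc t) (suc r) _ _ = ≤-trans (m≤m+n _ (2 * t * r + 2 * t + r)) (≤-reflexive (expand t r))
  where
  expand : ∀ t r → suc r + suc (suc t * suc r + suc t * suc r) + (2 * t * r + 2 * t + r) ≡ 4 * suc t * suc r
  expand = solve-∀

-- The chain has about 2^(−s−1) n vertices of negligible weight, while each rotational vertex
-- weighs at most (n/2)^s, so at least a fraction 1/(2K) of the homomorphisms is lost.
¬starSidorenko-≤ : ∀ a c → ¬ StarSidorenko (suc a) (suc a + c)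
¬starSidorenko-≤ a c sid = <⇒≱ tooFewHomomorphisms sidorenko
  where
  b = suc a + c
  s = suc a + b
  K = 4 * 2 ^ s
  q = 2 * K
  N = proj₁ (sid q)
  p = suc N
  k = 2 ^ s * p
  n = p + suc (k + k)
  τ = ChainOverRotational p k
  H = degreeMoment τ (suc a) b
  sidorenko : q * n ^ suc s ≤ suc q * (H * 2 ^ s)
  sidorenko = proj₂ (sid q) n (≤-trans (n≤1+n N) (m≤m+n p _)) τ
  qH2^s+n^[1+s]≤qn^[1+s] : q * (H * 2 ^ s) + n ^ suc s ≤ q * n ^ suc s
  qH2^s+n^[1+s]≤qn^[1+s] = begin
    q * (H * 2 ^ s) + n * n ^ s
      ≤⟨ +-mono-≤ (*-monoʳ-≤ q H*2^s≤2^s*U) (*-monoˡ-≤ (n ^ s) (p+[1+[t*p+t*p]]≤4*t*p (2 ^ s) p (m^n>0 2 s) z<s)) ⟩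
    q * (2 ^ s * U) + 4 * 2 ^ s * p * n ^ s
      ≡⟨ regroup K (2 ^ s * U) p (n ^ s) ⟩
    K * (2 * (2 ^ s * U) + p * n ^ s)
      ≤⟨ *-monoʳ-≤ K (chainOverRotational-deficit a c p k 2·2^s·p≤n) ⟩
    K * (2 * n ^ suc s)
      ≡⟨ trans (x∙yz≈y∙xz K 2 (n ^ suc s)) (sym (*-assoc 2 K (n ^ suc s))) ⟩
    q * n ^ suc s ∎
    where
    open ≤-Reasoning
    U = p * (p ^ suc a * n ^ b) + suc (k + k) * ((p + k) ^ suc a * k ^ b)
    H*2^s≤2^s*U : H * 2 ^ s ≤ 2 ^ s * U
    H*2^s≤2^s*U = subst (H * 2 ^ s ≤_) (*-comm U (2 ^ s)) (*-monoˡ-≤ (2 ^ s) (degreeMoment-ChainOverRotational-≤ p k (suc a) b))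
    regroup : ∀ K x p y → 2 * K * x + K * p * y ≡ K * (2 * x + p * y)
    regroup = solve-∀
    2·2^s·p≤n : 2 * 2 ^ s * p ≤ n
    2·2^s·p≤n = begin
      2 * 2 ^ s * p   ≡⟨ trans (*-assoc 2 (2 ^ s) p) (cong (k +_) (+-identityʳ k)) ⟩
      k + k           ≤⟨ ≤-trans (n≤1+n (k + k)) (m≤n+m _ p) ⟩
      n               ∎
  tooFewHomomorphisms : suc q * (H * 2 ^ s) < q * n ^ suc s
  tooFewHomomorphisms = q*w+x≤q*x⇒[1+q]*w<q*x q (n ^ suc s) (H * 2 ^ s) (m^n>0 n (suc s)) qH2^s+n^[1+s]≤qn^[1+s]

starSidorenko-swap : ∀ {a b} → StarSidorenko a b → StarSidorenko b a
starSidorenko-swap {a} {b} sid k = N , λ n n≥N τ →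
  subst (λ e → k * n ^ suc e ≤ suc k * (degreeMoment τ b a * 2 ^ e)) (+-comm a b)
    (subst (λ h → k * n ^ suc (a + b) ≤ suc k * (h * 2 ^ (a + b))) (degreeMoment-converse τ a b)
      (proj₂ (sid k) n n≥N (converse τ)))
  where N = proj₁ (sid k)

¬starSidorenko : ∀ a b → ¬ StarSidorenko (suc a) (suc b)
¬starSidorenko a b sid with ≤-total a b
... | inj₁ a≤b with c , refl ← m≤n⇒∃[o]m+o≡n a≤b = ¬starSidorenko-≤ a c sid
... | inj₂ b≤a with c , refl ← m≤n⇒∃[o]m+o≡n b≤a = ¬starSidorenko-≤ b c (starSidorenko-swap {suc a} sid)

starSidorenko⇔ : ∀ a b → StarSidorenko a b ⇔ (a ≡ 0 ⊎ b ≡ 0)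
starSidorenko⇔ a b = mk⇔ (necessary a b) sufficient
  where
  necessary : ∀ a b → StarSidorenko a b → a ≡ 0 ⊎ b ≡ 0
  necessary zero    b       _   = inj₁ refl
  necessary (suc a) zero    _   = inj₂ refl
  necessary (suc a) (suc b) sid = contradiction sid (¬starSidorenko a b)
  sufficient : a ≡ 0 ⊎ b ≡ 0 → StarSidorenko a b
  sufficient (inj₁ refl) = starSidorenko-out b
  sufficient (inj₂ refl) = starSidorenko-in a

-- Stars with unbalanced degrees are not anti-Sidorenko

[t+1]*[1+u]^[1+b]<[t+2]*u^[1+b] : ∀ b → let t = 2 + b; u = t * (t + 2) in
  (t + 1) * suc u ^ suc b < (t + 2) * u ^ suc b
[t+1]*[1+u]^[1+b]<[t+2]*u^[1+b] b = *-cancelˡ-< r _ _ (begin-strict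
  r * ((t + 1) * suc u ^ suc b)   ≡⟨ x∙yz≈y∙xz r (t + 1) (suc u ^ suc b) ⟩
  (t + 1) * (r * suc u ^ suc b)   ≡⟨ cong ((t + 1) *_) (*-comm r (suc u ^ suc b)) ⟩
  (t + 1) * (suc u ^ suc b * r)   ≤⟨ *-monoʳ-≤ (t + 1) ([1+m]^k*r≤m^[1+k] (suc b) u r (≤-reflexive (r+b+1≡u b))) ⟩
  (t + 1) * (u * u ^ suc b)       ≡⟨ *-assoc (t + 1) u (u ^ suc b) ⟨
  (t + 1) * u * u ^ suc b         <⟨ *-monoˡ-< (u ^ suc b) {{m^n≢0 u (suc b)}} [t+1]u<[t+2]r ⟩
  (t + 2) * r * u ^ suc b         ≡⟨ trans (*-assoc (t + 2) r (u ^ suc b)) (x∙yz≈y∙xz (t + 2) r (u ^ suc b)) ⟩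
  r * ((t + 2) * u ^ suc b)       ∎)
  where
  open ≤-Reasoning
  t = 2 + b
  u = t * (t + 2)
  r = t * t + t + 1
  r+b+1≡u : ∀ b → let t = 2 + b in t * t + t + 1 + suc b ≡ t * (t + 2)
  r+b+1≡u = solve-∀
  [t+1]u<[t+2]r : (t + 1) * u < (t + 2) * r
  [t+1]u<[t+2]r = subst ((t + 1) * u <_) (sym (expand t)) (m<m+n _ z<s)
    where
    expand : ∀ t → (t + 2) * (t * t + t + 1) ≡ (t + 1) * (t * (t + 2)) + (t + 2)
    expand = solve-∀

[t+1]^[1+a+b]<[t+2]^a*t^[1+b] : ∀ b d → let t = 2 + b; a = 2 + b + d in
  (t + 1) ^ suc (a + b) < (t + 2) ^ a * t ^ suc b
[t+1]^[1+a+b]<[t+2]^a*t^[1+b] b d = begin-strict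
  (t + 1) ^ suc (a + b)
    ≡⟨ cong ((t + 1) ^_) (exponent b d) ⟩
  (t + 1) ^ (suc d + (suc b + suc b))
    ≡⟨ trans (^-distribˡ-+-* (t + 1) (suc d) _) (cong ((t + 1) ^ suc d *_) (^-distribˡ-+-* (t + 1) (suc b) (suc b))) ⟩
  (t + 1) ^ suc d * ((t + 1) ^ suc b * (t + 1) ^ suc b)
    ≡⟨ cong ((t + 1) ^ suc d *_) (trans (sym (^-distribʳ-* (t + 1) (t + 1) (suc b))) (cong (_^ suc b) (square t))) ⟩
  (t + 1) * (t + 1) ^ d * suc u ^ suc b
    ≡⟨ x*y*z≡x*z*y (t + 1) ((t + 1) ^ d) (suc u ^ suc b) ⟩
  (t + 1) * suc u ^ suc b * (t + 1) ^ d
    <⟨ *-monoˡ-< ((t + 1) ^ d) {{m^n≢0 (t + 1) d}} ([t+1]*[1+u]^[1+b]<[t+2]*u^[1+b] b) ⟩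
  (t + 2) * u ^ suc b * (t + 1) ^ d
    ≤⟨ *-monoʳ-≤ ((t + 2) * u ^ suc b) (^-monoˡ-≤ d (+-monoʳ-≤ t (n≤1+n 1))) ⟩
  (t + 2) * u ^ suc b * (t + 2) ^ d
    ≡⟨ cong (λ x → (t + 2) * x * (t + 2) ^ d) (^-distribʳ-* t (t + 2) (suc b)) ⟩
  (t + 2) * (t ^ suc b * (t + 2) ^ suc b) * (t + 2) ^ d
    ≡⟨ regroup (t + 2) ((t + 2) ^ d) ((t + 2) ^ suc b) (t ^ suc b) ⟩
  (t + 2) * (t + 2) ^ d * (t + 2) ^ suc b * t ^ suc b
    ≡⟨ cong (_* t ^ suc b) (^-distribˡ-+-* (t + 2) (suc d) (suc b)) ⟨
  (t + 2) ^ (suc d + suc b) * t ^ suc b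
    ≡⟨ cong (λ e → (t + 2) ^ e * t ^ suc b) (exponent′ b d) ⟩
  (t + 2) ^ a * t ^ suc b ∎
  where
  open ≤-Reasoning
  t = 2 + b
  a = 2 + b + d
  u = t * (t + 2)
  exponent : ∀ b d → suc (2 + b + d + b) ≡ suc d + (suc b + suc b)
  exponent = solve-∀
  exponent′ : ∀ b d → suc d + suc b ≡ 2 + b + d
  exponent′ = solve-∀
  square : ∀ t → (t + 1) * (t + 1) ≡ suc (t * (t + 2))
  square = solve-∀
  x*y*z≡x*z*y : ∀ x y z → x * y * z ≡ x * z * y
  x*y*z≡x*z*y = solve-∀
  regroup : ∀ x y z w → x * (w * z) * y ≡ x * y * z * w
  regroup = solve-∀

[1+x*y]^[1+s]≤x^[1+s]*c : ∀ s y c → .{{_ : NonZero y}} → y ^ suc s < c →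
  let x = 2 * (suc s * suc (y ^ suc s)) in suc (x * y) ^ suc s ≤ x ^ suc s * c
[1+x*y]^[1+s]≤x^[1+s]*c s y@(suc y′) c D<c = *-cancelˡ-≤ r {{r≢0}} (begin
  r * suc N ^ suc s         ≡⟨ *-comm r (suc N ^ suc s) ⟩
  suc N ^ suc s * r         ≤⟨ [1+m]^k*r≤m^[1+k] (suc s) N r r+[1+s]≤N ⟩
  N * N ^ suc s             ≡⟨ cong (N *_) (^-distribʳ-* x y (suc s)) ⟩
  N * (x ^ suc s * D)       ≡⟨ x∙yz≈y∙xz N (x ^ suc s) D ⟩
  x ^ suc s * (N * D)       ≡⟨ cong (x ^ suc s *_) (r*[1+D]≡N*D s y D) ⟨
  x ^ suc s * (r * suc D)   ≤⟨ *-monoʳ-≤ (x ^ suc s) (*-monoʳ-≤ r D<c) ⟩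
  x ^ suc s * (r * c)       ≡⟨ x∙yz≈y∙xz (x ^ suc s) r c ⟩
  r * (x ^ suc s * c)       ∎)
  where
  open ≤-Reasoning
  D = y ^ suc s
  x = 2 * (suc s * suc D)
  N = x * y
  r = 2 * suc s * D * y
  r≢0 : NonZero r
  r≢0 = m*n≢0 (2 * suc s * D) y {{m*n≢0 (2 * suc s) D {{_}} {{m^n≢0 y (suc s)}}}}
  r+[1+s]+slack≡N : ∀ s y′ D → 2 * suc s * D * suc y′ + suc s + suc s * (2 * y′ + 1) ≡ 2 * (suc s * suc D) * suc y′
  r+[1+s]+slack≡N = solve-∀
  r+[1+s]≤N : r + suc s ≤ N
  r+[1+s]≤N = ≤-trans (m≤m+n _ (suc s * (2 * y′ + 1))) (≤-reflexive (r+[1+s]+slack≡N s y′ D))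
  r*[1+D]≡N*D : ∀ s y D → 2 * suc s * D * y * suc D ≡ 2 * (suc s * suc D) * y * D
  r*[1+D]≡N*D = solve-∀

[2j]^[1+a+b]*[t+2]^a*t^[1+b]≡2^[a+b]*[2tj*[[t+2]j]^a*[tj]^b] : ∀ a b t j →
  (2 * j) ^ suc (a + b) * ((t + 2) ^ a * t ^ suc b)
    ≡ 2 ^ (a + b) * ((t * j + t * j) * (((t + 2) * j) ^ a * (t * j) ^ b))
[2j]^[1+a+b]*[t+2]^a*t^[1+b]≡2^[a+b]*[2tj*[[t+2]j]^a*[tj]^b] a b t j = begin
  (2 * j) * (2 * j) ^ (a + b) * ((t + 2) ^ a * (t * t ^ b))
    ≡⟨ cong (λ z → (2 * j) * z * ((t + 2) ^ a * (t * t ^ b)))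
         (trans (^-distribˡ-+-* (2 * j) a b) (cong₂ _*_ (^-distribʳ-* 2 j a) (^-distribʳ-* 2 j b))) ⟩
  (2 * j) * ((2 ^ a * j ^ a) * (2 ^ b * j ^ b)) * ((t + 2) ^ a * (t * t ^ b))
    ≡⟨ regroup (2 ^ a) (2 ^ b) (j ^ a) (j ^ b) ((t + 2) ^ a) (t ^ b) t j ⟩
  2 ^ a * 2 ^ b * ((t * j + t * j) * (((t + 2) ^ a * j ^ a) * (t ^ b * j ^ b)))
    ≡⟨ cong₂ (λ x y → x * ((t * j + t * j) * y)) (^-distribˡ-+-* 2 a b)
         (cong₂ _*_ (^-distribʳ-* (t + 2) j a) (^-distribʳ-* t j b)) ⟨
  2 ^ (a + b) * ((t * j + t * j) * (((t + 2) * j) ^ a * (t * j) ^ b)) ∎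
  where
  open ≡-Reasoning
  regroup : ∀ A B P Q R S t j →
    (2 * j) * ((A * P) * (B * Q)) * (R * (t * S)) ≡ A * B * ((t * j + t * j) * ((R * P) * (S * Q)))
  regroup = solve-∀

-- The rotational vertices have degrees (t + 2) j and t j out of n = 2 (t + 1) j + 1, and
-- [t+1]^[1+a+b]<[t+2]^a*t^[1+b] says this skew beats the balanced split; j is large enough that
-- [1+x*y]^[1+s]≤x^[1+s]*c absorbs the + 1 in n.
¬starAntiSidorenko-≥ : ∀ b d → ¬ StarAntiSidorenko (2 + b + d) b
¬starAntiSidorenko-≥ b d anti = <-irrefl refl (begin-strict
  n ^ suc s
    ≡⟨ cong (_^ suc s) n≡1+xy ⟩
  suc (x * y) ^ suc s
    ≤⟨ [1+x*y]^[1+s]≤x^[1+s]*c s y C ([t+1]^[1+a+b]<[t+2]^a*t^[1+b] b d) ⟩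
  x ^ suc s * C
    ≡⟨ [2j]^[1+a+b]*[t+2]^a*t^[1+b]≡2^[a+b]*[2tj*[[t+2]j]^a*[tj]^b] a b t j ⟩
  2 ^ s * ((k + k) * (((t + 2) * j) ^ a * k ^ b))
    ≡⟨ cong (λ z → 2 ^ s * ((k + k) * (z ^ a * k ^ b))) p+k≡[t+2]j ⟨
  2 ^ s * ((k + k) * rotationalDegrees)
    <⟨ *-monoʳ-< (2 ^ s) {{m^n≢0 2 s}} (*-monoˡ-< rotationalDegrees {{rotationalDegrees≢0}} (n<1+n (k + k))) ⟩
  2 ^ s * (suc (k + k) * rotationalDegrees)
    ≤⟨ *-monoʳ-≤ (2 ^ s) (degreeMoment-ChainOverRotational-≥ p k a b) ⟩
  2 ^ s * degreeMoment τ a b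
    ≡⟨ *-comm (2 ^ s) _ ⟩
  degreeMoment τ a b * 2 ^ s
    ≤⟨ anti n z<s τ ⟩
  n ^ suc s ∎)
  where
  open ≤-Reasoning
  a = 2 + b + d
  s = a + b
  t = 2 + b
  y = t + 1
  C = (t + 2) ^ a * t ^ suc b
  j = suc s * suc (y ^ suc s)
  x = 2 * j
  p = 2 * j
  k = t * j
  n = p + suc (k + k)
  τ = ChainOverRotational p k
  rotationalDegrees = (p + k) ^ a * k ^ b
  rotationalDegrees≢0 : NonZero rotationalDegrees
  rotationalDegrees≢0 = m*n≢0 _ _ {{m^n≢0 (p + k) a}} {{m^n≢0 k b}}
  n≡1+xy : n ≡ suc (x * y)
  n≡1+xy = expand t j
    where
    expand : ∀ t j → 2 * j + suc (t * j + t * j) ≡ suc (2 * j * (t + 1))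
    expand = solve-∀
  p+k≡[t+2]j : p + k ≡ (t + 2) * j
  p+k≡[t+2]j = expand t j
    where
    expand : ∀ t j → 2 * j + t * j ≡ (t + 2) * j
    expand = solve-∀

starAntiSidorenko-swap : ∀ {a b} → StarAntiSidorenko a b → StarAntiSidorenko b a
starAntiSidorenko-swap {a} {b} anti n n≥1 τ =
  subst (λ e → degreeMoment τ b a * 2 ^ e ≤ n ^ suc e) (+-comm a b)
    (subst (λ h → h * 2 ^ (a + b) ≤ n ^ suc (a + b)) (degreeMoment-converse τ a b) (anti n n≥1 (converse τ)))

starAntiSidorenko⇒≤1+ : ∀ a b → StarAntiSidorenko a b → a ≤ suc b
starAntiSidorenko⇒≤1+ a b anti with a ≤? suc b
... | yes a≤1+b = a≤1+b
... | no  a≰1+b with d , refl ← m≤n⇒∃[o]m+o≡n (≰⇒> a≰1+b) = contradiction anti (¬starAntiSidorenko-≥ b d)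

starAntiSidorenko⇔ : ∀ a b → StarAntiSidorenko a b ⇔ (a ≤ suc b × b ≤ suc a)
starAntiSidorenko⇔ a b = mk⇔
  (λ anti → starAntiSidorenko⇒≤1+ a b anti , starAntiSidorenko⇒≤1+ b a (starAntiSidorenko-swap {a} anti))
  (λ (a≤1+b , b≤1+a) → starAntiSidorenko-balanced a b a≤1+b b≤1+a)

edgeE-into-0 : ∀ x → edgeE x zero ≡ false
edgeE-into-0 zero       = refl
edgeE-into-0 (suc zero) = refl

edgeE-out-of-1 : ∀ y → edgeE (suc zero) y ≡ false
edgeE-out-of-1 zero       = refl
edgeE-out-of-1 (suc zero) = refl

≡true⇒≢false : ∀ {b} → b ≡ true → b ≢ false
≡true⇒≢false refl ()

hom-to-SingleEdge⇒oriented : ∀ s (o : Fin s → Bool) → ∃ (λ φ → IsHom (Star s o) SingleEdge φ) →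
  (∀ i → o i ≡ false) ⊎ (∀ i → not (o i) ≡ false)
hom-to-SingleEdge⇒oriented s o (φ , hom) with φ zero in φ₀
... | zero     = inj₁ λ i → ¬-not λ oᵢ →
  ≡true⇒≢false (hom (suc i) zero oᵢ) (subst (λ c → edgeE (φ (suc i)) c ≡ false) (sym φ₀) (edgeE-into-0 (φ (suc i))))
... | suc zero = inj₂ λ i → ¬-not λ ¬oᵢ →
  ≡true⇒≢false (hom zero (suc i) ¬oᵢ) (subst (λ c → edgeE c (φ (suc i)) ≡ false) (sym φ₀) (edgeE-out-of-1 (φ (suc i))))

oriented⇒hom-to-SingleEdge : ∀ s (o : Fin s → Bool) → (∀ i → o i ≡ false) ⊎ (∀ i → not (o i) ≡ false) →
  ∃ (λ φ → IsHom (Star s o) SingleEdge φ)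
oriented⇒hom-to-SingleEdge s o (inj₁ outward) = φ , hom
  where
  φ : Fin (suc s) → Fin 2
  φ zero    = zero
  φ (suc _) = suc zero
  hom : IsHom (Star s o) SingleEdge φ
  hom zero    (suc i) _  = refl
  hom (suc i) zero    oᵢ = contradiction (outward i) (≡true⇒≢false oᵢ)
oriented⇒hom-to-SingleEdge s o (inj₂ inward) = φ , hom
  where
  φ : Fin (suc s) → Fin 2
  φ zero    = suc zero
  φ (suc _) = zero
  hom : IsHom (Star s o) SingleEdge φ
  hom zero    (suc i) ¬oᵢ = contradiction (inward i) (≡true⇒≢false ¬oᵢ)
  hom (suc i) zero    _   = refl

hom-to-SingleEdge⇔ : ∀ s (o : Fin s → Bool) →
  ∃ (λ φ → IsHom (Star s o) SingleEdge φ) ⇔ (∑[ i < s ] ⟦ o i ⟧ ≡ 0 ⊎ ∑[ i < s ] ⟦ not (o i) ⟧ ≡ 0)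
hom-to-SingleEdge⇔ s o = mk⇔
  (Sum.map (∑-⟦false⟧ o) (∑-⟦false⟧ (not ∘ o)) ∘ hom-to-SingleEdge⇒oriented s o)
  (oriented⇒hom-to-SingleEdge s o ∘ Sum.map (∑-⟦⟧≡0 o) (∑-⟦⟧≡0 (not ∘ o)))

module _ (s : ℕ) (o : Fin s → Bool) where

  private
    a b : ℕ
    a = ∑[ i < s ] ⟦ o i ⟧
    b = ∑[ i < s ] ⟦ not (o i) ⟧

    weightedHomCount : ∀ {n} (τ : Tournament n) →
      homCount (Star s o) τ * 2 ^ edgeCount (Star s o) ≡ degreeMoment τ a b * 2 ^ (a + b)
    weightedHomCount τ = cong₂ _*_ (homCount-Star s o τ) (cong (2 ^_) (edgeCount-Star s o))

    n^size : ∀ n → n ^ size (Star s o) ≡ n ^ suc (a + b)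
    n^size n = cong (λ e → n ^ suc e) (sym (∑-⟦⟧+∑-⟦not⟧ o))

  TournamentSidorenko-Star⇔ : TournamentSidorenko (Star s o) ⇔ StarSidorenko a b
  TournamentSidorenko-Star⇔ = mk⇔
    (λ sid k → proj₁ (sid k) , λ n n≥N τ →
      subst₂ _≤_ (cong (k *_) (n^size n)) (cong (suc k *_) (weightedHomCount τ)) (proj₂ (sid k) n n≥N τ))
    (λ sid k → proj₁ (sid k) , λ n n≥N τ →
      subst₂ _≤_ (cong (k *_) (sym (n^size n))) (cong (suc k *_) (sym (weightedHomCount τ))) (proj₂ (sid k) n n≥N τ))

  TournamentAntiSidorenko-Star⇔ : TournamentAntiSidorenko (Star s o) ⇔ StarAntiSidorenko a b
  TournamentAntiSidorenko-Star⇔ = mk⇔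
    (λ anti n n≥1 τ → subst₂ _≤_ (weightedHomCount τ) (n^size n) (anti n n≥1 τ))
    (λ anti n n≥1 τ → subst₂ _≤_ (sym (weightedHomCount τ)) (sym (n^size n)) (anti n n≥1 τ))

  centerDegrees⇔ : (centerIndeg s o ≤ centerOutdeg s o + 1 × centerOutdeg s o ≤ centerIndeg s o + 1)
    ⇔ (a ≤ suc b × b ≤ suc a)
  centerDegrees⇔
    rewrite sum-map-tabulate s (λ i → i) (λ i → ⟦ o i ⟧) | sum-map-tabulate s (λ i → i) (λ i → ⟦ not (o i) ⟧)
          | +-comm a 1 | +-comm b 1 = ⇔-id _

theorem1p11 : (s : ℕ) → (o : Fin s → Bool) →
    (TournamentSidorenko (Star s o) ⇔ ∃ (λ φ → IsHom (Star s o) SingleEdge φ))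
    × (TournamentAntiSidorenko (Star s o) ⇔
    (centerIndeg s o ≤ centerOutdeg s o + 1 × centerOutdeg s o ≤ centerIndeg s o + 1))
theorem1p11 s o =
  ⇔-sym (hom-to-SingleEdge⇔ s o) ⇔-∘ (starSidorenko⇔ _ _ ⇔-∘ TournamentSidorenko-Star⇔ s o) ,
  ⇔-sym (centerDegrees⇔ s o) ⇔-∘ (starAntiSidorenko⇔ _ _ ⇔-∘ TournamentAntiSidorenko-Star⇔ s o)
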